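{- Let $p\geq 5$ be a prime with Legendre symbol $\left(\frac{ -2}{p}\right)=-1$, and let $t$ be a positive integer with $\gcd(t,6)=1$ and $p\mid t$. Then for all integers $n\geq 0$ and all $1\leq j\leq p-1$, \[ T_2\left(9t^2n+\frac{9t^2j}{p}+\frac{57t^2-1}{8}\right)\equiv 0\pmod 6. \]
   Context: A partition of a non-negative integer $n$ is $\ell$-regular if none of its parts is divisible by $\ell$ (the empty partition of $0$ counts). A $k$-tuple $\ell$-regular partition of $n$ is a sequence $(\lambda_1,\dots,\lambda_k)$ where $\lambda_i$ is an $\ell$-regular partition of $n_i\ge 0$ and $n_1+\cdots+n_k=n$. $T_{\ell,k}(n)$ denotes the number of $k$-tuple $\ell$-regular partitions of $n$, and $T_\ell(n):=T_{\ell,3}(n)$. Equivalently, $\sum_{n\ge0}T_{\ell,k}(n)q^n=\prod_{i\ge1}\frac{(1-q^{\ell i})^k}{(1-q^i)^k}$. -}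

module Defs where

open import Data.Nat using (ℕ; zero; suc; _+_; _*_; _∸_; _≤?_; _≟_)
open import Data.Nat.Divisibility using (_∣?_)
open import Relation.Nullary.Decidable using (does)
open import Data.Bool using (if_then_else_; _∨_)
open import Data.List using (List; []; _∷_; map; upTo)
open import Data.Nat.ListAction using (sum)

-- regParts ℓ f m n : number of partitions of n into parts that are ≤ m and
-- not divisible by ℓ, computed by recursion on a fuel f (correct whenever n ≤ f).
-- Recurrence: either no part equals m, or remove one part m.
regParts : ℕ → ℕ → ℕ → ℕ → ℕ
regParts ℓ f zero n = if does (n ≟ 0) then 1 else 0
regParts ℓ zero (suc m) n = if does (n ≟ 0) then 1 else 0
regParts ℓ (suc f) (suc m) n =
  regParts ℓ (suc f) m n +
  (if does (ℓ ∣? suc m) ∨ does (suc n ≤? suc m) then 0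
   else regParts ℓ f (suc m) (n ∸ suc m))

regPart : ℕ → ℕ → ℕ
regPart ℓ n = regParts ℓ n n n

-- T ℓ k n : number of k-tuple ℓ-regular partitions of n
-- (k-fold convolution: T_{ℓ,0}(n) = [n = 0],
--  T_{ℓ,k+1}(n) = Σ_{a=0}^{n} regPart ℓ a * T_{ℓ,k}(n - a)).
T : ℕ → ℕ → ℕ → ℕ
T ℓ zero n = if does (n ≟ 0) then 1 else 0
T ℓ (suc k) n = sum (map (λ a → regPart ℓ a * T ℓ k (n ∸ a)) (upTo (suc n)))

T₃ : ℕ → ℕ → ℕ
T₃ ℓ n = T ℓ 3 n

-- Let A = ∏ (1 − q^(2i))/(1 − q^i) be the generating function of 2-regular partitions,
-- so that Σ T₂(n) qⁿ = A³.
--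
-- Modulo 3, A³ ≡ A(q³), hence T₂(n) ≡ 0 (mod 3) whenever 3 ∤ n.
--
-- Modulo 2, write P = 1/∏(1 − q^i) and Q = ∏(1 + q^i). Euler's factorisation P = A·P(q²)
-- together with P(q²) ≡ P² and Q·P ≡ 1 gives A·P ≡ 1 and A ≡ Q. Gauss's identity
-- Q² = P·Σ_k q^(k(k+1)/2), obtained as the limit of a finite Jacobi triple product in
-- Gaussian binomial coefficients, then yields A³ ≡ A·Q² = (A·P)·Σ_k q^(k(k+1)/2)
-- ≡ Σ_k q^(k(k+1)/2). So T₂(n) is even unless n is triangular, i.e. unless 8n + 1 is a square.
--
-- For the N of the theorem write t = s·p and t = 2u + 1. Then N = 1 + 3(…), and
-- 8N + 1 = p·s²·3(24pn + 24j + 19p), where p divides neither 3 nor 24pn + 24j + 19p.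
-- The exponent of p in 8N + 1 is odd, so 8N + 1 is not a square.

module Submission where

open import Algebra.Bundles using (CommutativeSemiring)
open import Algebra.Definitions using (Congruent₂)
open import Algebra.Structures.Biased using (isCommutativeSemiringˡ)
open import Data.Bool using (Bool; true; false; if_then_else_; not; _∨_) renaming (T to True)
open import Data.List using (map; upTo; applyUpTo)
open import Data.List.Properties using (map-applyUpTo)
open import Data.Nat
open import Data.Nat.DivMod using (_%_; _/_; %-distribˡ-+; %-distribˡ-*; %-remove-+ʳ; m%n<n; m*n/n≡m; m≡m%n+[m/n]*n)
open import Data.Nat.Divisibility using (_∣_; _∣?_; divides; ∣⇒≤; >⇒∤; m%n≡0⇒n∣m; ∣m+n∣m⇒∣n; m∣m*n)
open import Data.Nat.GCD using (gcd; gcd-greatest)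
open import Data.Nat.Induction using (<-rec)
open import Data.Nat.LCM using (lcm-least)
open import Data.Nat.ListAction using (sum)
open import Data.Nat.Primality using (Prime; euclidsLemma; prime⇒nonTrivial; prime⇒nonZero)
open import Data.Nat.Properties
open import Data.Nat.Tactic.RingSolver using (solve-∀)
open import Data.Product using (∃; _×_; _,_)
open import Data.Sum using (_⊎_; inj₁; inj₂; [_,_]′; reduce)
open import Function using (_∘_; id)
open import Level using (0ℓ)
open import Relation.Binary.Bundles using (Setoid)
open import Relation.Binary.Core using (Rel)
open import Relation.Binary.PropositionalEquality
import Relation.Binary.Reasoning.Setoid
open import Relation.Nullary using (¬_; contradiction; yes; no; does)
open import Relation.Nullary.Decidable using (dec-true; dec-false)

open import Defs

-- Power series with natural coefficients

Series : Set
Series = ℕ → ℕ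

infixl 6 _⊕_
infixl 7 _⊗_
infixr 8 _•_

𝟘 : Series
𝟘 _ = 0

𝟙 : Series
𝟙 zero    = 1
𝟙 (suc _) = 0

_⊕_ : Series → Series → Series
(f ⊕ g) n = f n + g n

_•_ : ℕ → Series → Series
(c • f) n = c * f n

tail : Series → Series
tail f n = f (suc n)

_⊗_ : Series → Series → Series
(f ⊗ g) zero    = f 0 * g 0
(f ⊗ g) (suc n) = f 0 * g (suc n) + (tail f ⊗ g) n

shift : ℕ → Series → Series
shift zero    f         = f
shift (suc k) f zero    = 0
shift (suc k) f (suc n) = shift k f n

infix 4 _≗[≤_]_
_≗[≤_]_ : Series → ℕ → Series → Set
f ≗[≤ n ] g = ∀ i → i ≤ n → f i ≡ g i

⊗-respects : ∀ {R : Rel ℕ 0ℓ} → Congruent₂ R _+_ → Congruent₂ R _*_ →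
             ∀ n {f f' g g'} → (∀ i → i ≤ n → R (f i) (f' i)) → (∀ i → i ≤ n → R (g i) (g' i)) →
             R ((f ⊗ g) n) ((f' ⊗ g') n)
⊗-respects +-cong *-cong zero {f} {f'} {g} {g'} f~f' g~g' =
  *-cong {f 0} {f' 0} {g 0} {g' 0} (f~f' 0 z≤n) (g~g' 0 z≤n)
⊗-respects {R} +-cong *-cong (suc n) {f} {f'} {g} {g'} f~f' g~g' =
  +-cong {f 0 * g (suc n)} {f' 0 * g' (suc n)}
    (*-cong {f 0} {f' 0} {g (suc n)} {g' (suc n)} (f~f' 0 z≤n) (g~g' (suc n) ≤-refl))
    (⊗-respects {R} +-cong *-cong n {tail f} {tail f'}
      (λ i i≤n → f~f' (suc i) (s≤s i≤n)) (λ i i≤n → g~g' i (m≤n⇒m≤1+n i≤n)))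

⊗-agree : ∀ {f f' g g'} n → f ≗[≤ n ] f' → g ≗[≤ n ] g' → (f ⊗ g) n ≡ (f' ⊗ g') n
⊗-agree n = ⊗-respects {_≡_} (cong₂ _+_) (cong₂ _*_) n

⊗-cong : ∀ {f f' g g'} → f ≗ f' → g ≗ g' → f ⊗ g ≗ f' ⊗ g'
⊗-cong f≗f' g≗g' n = ⊗-agree n (λ i _ → f≗f' i) (λ i _ → g≗g' i)

⊕-cong : ∀ {f f' g g'} → f ≗ f' → g ≗ g' → f ⊕ g ≗ f' ⊕ g'
⊕-cong f≗f' g≗g' n = cong₂ _+_ (f≗f' n) (g≗g' n)

⊗-sucʳ : ∀ f g n → (f ⊗ g) (suc n) ≡ (f ⊗ tail g) n + f (suc n) * g 0
⊗-sucʳ f g zero    = refl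
⊗-sucʳ f g (suc n) = begin
  f 0 * g (2 + n) + (tail f ⊗ g) (suc n)                      ≡⟨ cong (f 0 * g (2 + n) +_) (⊗-sucʳ (tail f) g n) ⟩
  f 0 * g (2 + n) + ((tail f ⊗ tail g) n + f (2 + n) * g 0)   ≡⟨ +-assoc (f 0 * g (2 + n)) _ _ ⟨
  f 0 * g (2 + n) + (tail f ⊗ tail g) n + f (2 + n) * g 0     ∎
  where open ≡-Reasoning

⊗-comm : ∀ f g → f ⊗ g ≗ g ⊗ f
⊗-comm f g zero    = *-comm (f 0) (g 0)
⊗-comm f g (suc n) = begin
  f 0 * g (suc n) + (tail f ⊗ g) n   ≡⟨ cong₂ _+_ (*-comm (f 0) (g (suc n))) (⊗-comm (tail f) g n) ⟩
  g (suc n) * f 0 + (g ⊗ tail f) n   ≡⟨ +-comm (g (suc n) * f 0) _ ⟩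
  (g ⊗ tail f) n + g (suc n) * f 0   ≡⟨ ⊗-sucʳ g f n ⟨
  (g ⊗ f) (suc n)                    ∎
  where open ≡-Reasoning

⊗-distribʳ-⊕ : ∀ h f g → (f ⊕ g) ⊗ h ≗ f ⊗ h ⊕ g ⊗ h
⊗-distribʳ-⊕ h f g zero    = *-distribʳ-+ (h 0) (f 0) (g 0)
⊗-distribʳ-⊕ h f g (suc n) = begin
  (f 0 + g 0) * h (suc n) + (tail (f ⊕ g) ⊗ h) n
    ≡⟨ cong₂ _+_ (*-distribʳ-+ (h (suc n)) (f 0) (g 0)) (⊗-distribʳ-⊕ h (tail f) (tail g) n) ⟩
  (f 0 * h (suc n) + g 0 * h (suc n)) + ((tail f ⊗ h) n + (tail g ⊗ h) n)
    ≡⟨ exchange (f 0 * h (suc n)) (g 0 * h (suc n)) _ _ ⟩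
  (f 0 * h (suc n) + (tail f ⊗ h) n) + (g 0 * h (suc n) + (tail g ⊗ h) n)
    ∎
  where
  open ≡-Reasoning
  exchange : ∀ a b c d → (a + b) + (c + d) ≡ (a + c) + (b + d)
  exchange = solve-∀

•-⊗ : ∀ c f g → c • f ⊗ g ≗ c • (f ⊗ g)
•-⊗ c f g zero    = *-assoc c (f 0) (g 0)
•-⊗ c f g (suc n) =
  trans (cong₂ _+_ (*-assoc c (f 0) (g (suc n))) (•-⊗ c (tail f) g n)) (sym (*-distribˡ-+ c _ _))

⊗-assoc : ∀ f g h → (f ⊗ g) ⊗ h ≗ f ⊗ (g ⊗ h)
⊗-assoc f g h zero    = *-assoc (f 0) (g 0) (h 0)
⊗-assoc f g h (suc n) = begin
  f 0 * g 0 * h (suc n) + (tail (f ⊗ g) ⊗ h) n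
    ≡⟨ cong (f 0 * g 0 * h (suc n) +_) (⊗-distribʳ-⊕ h (f 0 • tail g) (tail f ⊗ g) n) ⟩
  f 0 * g 0 * h (suc n) + ((f 0 • tail g ⊗ h) n + ((tail f ⊗ g) ⊗ h) n)
    ≡⟨ cong₂ (λ x y → f 0 * g 0 * h (suc n) + (x + y)) (•-⊗ (f 0) (tail g) h n) (⊗-assoc (tail f) g h n) ⟩
  f 0 * g 0 * h (suc n) + (f 0 * (tail g ⊗ h) n + (tail f ⊗ (g ⊗ h)) n)
    ≡⟨ regroup (f 0) (g 0) (h (suc n)) _ _ ⟩
  f 0 * (g 0 * h (suc n) + (tail g ⊗ h) n) + (tail f ⊗ (g ⊗ h)) n
    ∎
  where
  open ≡-Reasoning
  regroup : ∀ a b c x y → a * b * c + (a * x + y) ≡ a * (b * c + x) + y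
  regroup = solve-∀

⊗-zeroˡ : ∀ f → 𝟘 ⊗ f ≗ 𝟘
⊗-zeroˡ f zero    = refl
⊗-zeroˡ f (suc n) = ⊗-zeroˡ f n

⊗-identityˡ : ∀ f → 𝟙 ⊗ f ≗ f
⊗-identityˡ f zero    = +-identityʳ (f 0)
⊗-identityˡ f (suc n) = trans (cong₂ _+_ (+-identityʳ _) (⊗-zeroˡ f n)) (+-identityʳ _)

⊗-identityʳ : ∀ f → f ⊗ 𝟙 ≗ f
⊗-identityʳ f n = trans (⊗-comm f 𝟙 n) (⊗-identityˡ f n)

seriesSemiring : CommutativeSemiring 0ℓ 0ℓ
seriesSemiring = record
  { Carrier = Series ; _≈_ = _≗_ ; _+_ = _⊕_ ; _*_ = _⊗_ ; 0# = 𝟘 ; 1# = 𝟙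
  ; isCommutativeSemiring = isCommutativeSemiringˡ record
    { +-isCommutativeMonoid = record
      { isMonoid = record
        { isSemigroup = record
          { isMagma = record { isEquivalence = Setoid.isEquivalence (ℕ →-setoid ℕ) ; ∙-cong = ⊕-cong }
          ; assoc = λ f g h n → +-assoc (f n) (g n) (h n) }
        ; identity = (λ f n → refl) , (λ f n → +-identityʳ (f n)) }
      ; comm = λ f g n → +-comm (f n) (g n) }
    ; *-isCommutativeMonoid = record
      { isMonoid = record
        { isSemigroup = record
          { isMagma = record { isEquivalence = Setoid.isEquivalence (ℕ →-setoid ℕ) ; ∙-cong = ⊗-cong }
          ; assoc = ⊗-assoc }
        ; identity = ⊗-identityˡ , ⊗-identityʳ }
      ; comm = ⊗-comm }
    ; distribʳ = ⊗-distribʳ-⊕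
    ; zeroˡ = ⊗-zeroˡ
    }
  }

open import Algebra.Solver.Ring.NaturalCoefficients.Default seriesSemiring
  using (solve; _:+_; _:*_; _:=_; con)

module ≗-Reasoning = Relation.Binary.Reasoning.Setoid (ℕ →-setoid ℕ)

⊗-distribˡ-⊕ : ∀ f g h → f ⊗ (g ⊕ h) ≗ f ⊗ g ⊕ f ⊗ h
⊗-distribˡ-⊕ = solve 3 (λ f g h → f :* (g :+ h) := f :* g :+ f :* h) (λ _ → refl)

⊗-unfoldˡ : ∀ f g → f ⊗ g ≗ f 0 • g ⊕ shift 1 (tail f ⊗ g)
⊗-unfoldˡ f g zero    = sym (+-identityʳ _)
⊗-unfoldˡ f g (suc n) = refl

decompose : ∀ f → f ≗ f 0 • 𝟙 ⊕ shift 1 (tail f)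
decompose f zero    = sym (trans (+-identityʳ _) (*-identityʳ (f 0)))
decompose f (suc n) = sym (cong (_+ f (suc n)) (*-zeroʳ (f 0)))

•𝟙-⊗ : ∀ c d → c • 𝟙 ⊗ d • 𝟙 ≗ (c * d) • 𝟙
•𝟙-⊗ c d n = begin
  (c • 𝟙 ⊗ d • 𝟙) n      ≡⟨ •-⊗ c 𝟙 (d • 𝟙) n ⟩
  c * (𝟙 ⊗ d • 𝟙) n      ≡⟨ cong (c *_) (⊗-identityˡ (d • 𝟙) n) ⟩
  c * (d * 𝟙 n)          ≡⟨ *-assoc c d (𝟙 n) ⟨
  c * d * 𝟙 n            ∎
  where open ≡-Reasoning

shift-cong : ∀ k {f g} → f ≗ g → shift k f ≗ shift k g
shift-cong zero    f≗g n       = f≗g n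
shift-cong (suc k) f≗g zero    = refl
shift-cong (suc k) f≗g (suc n) = shift-cong k f≗g n

shift-⊕ : ∀ k f g → shift k (f ⊕ g) ≗ shift k f ⊕ shift k g
shift-⊕ zero    f g n       = refl
shift-⊕ (suc k) f g zero    = refl
shift-⊕ (suc k) f g (suc n) = shift-⊕ k f g n

shift-+ : ∀ a b f → shift (a + b) f ≗ shift a (shift b f)
shift-+ zero    b f n       = refl
shift-+ (suc a) b f zero    = refl
shift-+ (suc a) b f (suc n) = shift-+ a b f n

shift-𝟘 : ∀ k → shift k 𝟘 ≗ 𝟘
shift-𝟘 zero    n       = refl
shift-𝟘 (suc k) zero    = refl
shift-𝟘 (suc k) (suc n) = shift-𝟘 k n

shift-below : ∀ k f {n} → n < k → shift k f n ≡ 0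
shift-below (suc k) f {zero}  _         = refl
shift-below (suc k) f {suc n} (s≤s n<k) = shift-below k f n<k

shift-at : ∀ k f n → shift k f (k + n) ≡ f n
shift-at zero    f n = refl
shift-at (suc k) f n = shift-at k f n

shift-𝟙-off : ∀ k {n} → k ≢ n → shift k 𝟙 n ≡ 0
shift-𝟙-off zero    {zero}  0≢0 = contradiction refl 0≢0
shift-𝟙-off zero    {suc n} _   = refl
shift-𝟙-off (suc k) {zero}  _   = refl
shift-𝟙-off (suc k) {suc n} k≢n = shift-𝟙-off k (k≢n ∘ cong suc)

shift-agree : ∀ k {f g} n → (∀ m → k + m ≡ n → f m ≡ g m) → shift k f n ≡ shift k g n
shift-agree zero    n       f≡g = f≡g n refl
shift-agree (suc k) zero    f≡g = refl
shift-agree (suc k) (suc n) f≡g = shift-agree k n (λ m k+m≡n → f≡g m (cong suc k+m≡n))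

shift-agree-below : ∀ k .{{_ : NonZero k}} {f g} n → (∀ {m} → m < n → f m ≡ g m) → shift k f n ≡ shift k g n
shift-agree-below k n f≡g =
  shift-agree k n (λ m k+m≡n → f≡g (subst (m <_) k+m≡n (m<n+m m (>-nonZero⁻¹ k))))

shift-shift-index : ∀ a b c d {f} → f ≗ 𝟘 ⊎ a + b ≡ c + d → shift a (shift b f) ≗ shift c (shift d f)
shift-shift-index a b c d {f} (inj₁ f≗𝟘) n = begin
  shift a (shift b f) n   ≡⟨ shift-cong a (shift-cong b f≗𝟘) n ⟩
  shift a (shift b 𝟘) n   ≡⟨ trans (shift-cong a (shift-𝟘 b) n) (shift-𝟘 a n) ⟩
  0                       ≡⟨ trans (shift-cong c (shift-𝟘 d) n) (shift-𝟘 c n) ⟨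
  shift c (shift d 𝟘) n   ≡⟨ shift-cong c (shift-cong d f≗𝟘) n ⟨
  shift c (shift d f) n   ∎
  where open ≡-Reasoning
shift-shift-index a b c d {f} (inj₂ a+b≡c+d) n = begin
  shift a (shift b f) n   ≡⟨ shift-+ a b f n ⟨
  shift (a + b) f n       ≡⟨ cong (λ i → shift i f n) a+b≡c+d ⟩
  shift (c + d) f n       ≡⟨ shift-+ c d f n ⟩
  shift c (shift d f) n   ∎
  where open ≡-Reasoning

shift-⊗ˡ : ∀ k f g → shift k f ⊗ g ≗ shift k (f ⊗ g)
shift-⊗ˡ zero    f g n       = refl
shift-⊗ˡ (suc k) f g zero    = refl
shift-⊗ˡ (suc k) f g (suc n) = shift-⊗ˡ k f g n

shift-⊗ʳ : ∀ k f g → f ⊗ shift k g ≗ shift k (f ⊗ g)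
shift-⊗ʳ k f g n = trans (⊗-comm f (shift k g) n) (trans (shift-⊗ˡ k g f n) (shift-cong k (⊗-comm g f) n))

⊗-shift-𝟙 : ∀ k f → f ⊗ shift k 𝟙 ≗ shift k f
⊗-shift-𝟙 k f n = trans (shift-⊗ʳ k f 𝟙 n) (shift-cong k (⊗-identityʳ f) n)

shift-⊗-shift : ∀ a b f g → shift a f ⊗ shift b g ≗ shift (a + b) (f ⊗ g)
shift-⊗-shift a b f g n = begin
  (shift a f ⊗ shift b g) n     ≡⟨ shift-⊗ˡ a f (shift b g) n ⟩
  shift a (f ⊗ shift b g) n     ≡⟨ shift-cong a (shift-⊗ʳ b f g) n ⟩
  shift a (shift b (f ⊗ g)) n   ≡⟨ shift-+ a b (f ⊗ g) n ⟨
  shift (a + b) (f ⊗ g) n       ∎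
  where open ≡-Reasoning

shift-𝟙-⊗ : ∀ a b → shift a 𝟙 ⊗ shift b 𝟙 ≗ shift (a + b) 𝟙
shift-𝟙-⊗ a b n = trans (shift-⊗-shift a b 𝟙 𝟙 n) (shift-cong (a + b) (⊗-identityˡ 𝟙) n)

fixpoint-unique : ∀ k .{{_ : NonZero k}} u {h h'} → h ≗ u ⊕ shift k h → h' ≗ u ⊕ shift k h' → h ≗ h'
fixpoint-unique k u {h} {h'} h-fix h'-fix = <-rec (λ n → h n ≡ h' n) step
  where
  step : ∀ n → (∀ {m} → m < n → h m ≡ h' m) → h n ≡ h' n
  step n rec = trans (h-fix n) (trans (cong (u n +_) (shift-agree-below k n rec)) (sym (h'-fix n)))

Stable : (ℕ → Series) → Set
Stable F = ∀ {m n} → n ≤ m → F m n ≡ F n n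

limit : (ℕ → Series) → Series
limit F n = F n n

limit-agree : ∀ {F} → Stable F → ∀ {n m} → n ≤ m → limit F ≗[≤ n ] F m
limit-agree stable n≤m i i≤n = sym (stable (≤-trans i≤n n≤m))

∑ : ℕ → (ℕ → Series) → Series
∑ zero    h = 𝟘
∑ (suc L) h = h 0 ⊕ ∑ L (h ∘ suc)

∑-length : ∀ {L L'} h → L ≡ L' → ∑ L h ≗ ∑ L' h
∑-length h refl n = refl

∑-cong-at : ∀ L {h h'} n → (∀ r → h r n ≡ h' r n) → ∑ L h n ≡ ∑ L h' n
∑-cong-at zero    n h≡h' = refl
∑-cong-at (suc L) n h≡h' = cong₂ _+_ (h≡h' 0) (∑-cong-at L n (h≡h' ∘ suc))

∑-cong : ∀ L {h h'} → (∀ r → h r ≗ h' r) → ∑ L h ≗ ∑ L h'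
∑-cong L h≗h' n = ∑-cong-at L n (λ r → h≗h' r n)

∑-vanishes-at : ∀ L h n → (∀ r → h r n ≡ 0) → ∑ L h n ≡ 0
∑-vanishes-at zero    h n h≡0 = refl
∑-vanishes-at (suc L) h n h≡0 = cong₂ _+_ (h≡0 0) (∑-vanishes-at L (h ∘ suc) n (h≡0 ∘ suc))

∑-⊕ : ∀ L h h' → ∑ L (λ r → h r ⊕ h' r) ≗ ∑ L h ⊕ ∑ L h'
∑-⊕ zero    h h' n = refl
∑-⊕ (suc L) h h' n =
  trans (cong (h 0 n + h' 0 n +_) (∑-⊕ L (h ∘ suc) (h' ∘ suc) n)) (exchange (h 0 n) _ _ _)
  where
  exchange : ∀ a b c d → a + b + (c + d) ≡ a + c + (b + d)
  exchange = solve-∀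

∑-shift : ∀ k L h → ∑ L (λ r → shift k (h r)) ≗ shift k (∑ L h)
∑-shift k zero    h n = sym (shift-𝟘 k n)
∑-shift k (suc L) h n =
  trans (cong (shift k (h 0) n +_) (∑-shift k L (h ∘ suc) n)) (sym (shift-⊕ k (h 0) _ n))

∑-⊗ : ∀ L h g → ∑ L h ⊗ g ≗ ∑ L (λ r → h r ⊗ g)
∑-⊗ zero    h g = ⊗-zeroˡ g
∑-⊗ (suc L) h g n =
  trans (⊗-distribʳ-⊕ g (h 0) (∑ L (h ∘ suc)) n) (cong ((h 0 ⊗ g) n +_) (∑-⊗ L (h ∘ suc) g n))

∑-snoc : ∀ L h → ∑ (suc L) h ≗ ∑ L h ⊕ h L
∑-snoc zero    h n = +-comm (h 0 n) 0
∑-snoc (suc L) h n = trans (cong (h 0 n +_) (∑-snoc L (h ∘ suc) n)) (sym (+-assoc (h 0 n) _ _))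

∑-vanishing-last : ∀ L h n → h L n ≡ 0 → ∑ (suc L) h n ≡ ∑ L h n
∑-vanishing-last L h n hLn≡0 = trans (∑-snoc L h n) (trans (cong (∑ L h n +_) hLn≡0) (+-identityʳ _))

-- Dilation and geometric series

-- spread k r f has r zeros, then f 0, then k zeros, then f 1, then k zeros, then f 2, …
spread : ℕ → ℕ → Series → Series
spread k zero    f zero    = f 0
spread k (suc r) f zero    = 0
spread k zero    f (suc n) = spread k k (tail f) n
spread k (suc r) f (suc n) = spread k r f n

dilate : (k : ℕ) .{{_ : NonZero k}} → Series → Series
dilate (suc k) = spread k 0

ones : Series
ones _ = 1

geometric : (k : ℕ) .{{_ : NonZero k}} → Series
geometric k = dilate k ones

spread-shift : ∀ k r f → spread k r f ≗ shift r (spread k 0 f)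
spread-shift k zero    f n       = refl
spread-shift k (suc r) f zero    = refl
spread-shift k (suc r) f (suc n) = spread-shift k r f n

spread-cong : ∀ k r {f g} → f ≗ g → spread k r f ≗ spread k r g
spread-cong k zero    f≗g zero    = f≗g 0
spread-cong k (suc r) f≗g zero    = refl
spread-cong k zero    f≗g (suc n) = spread-cong k k (f≗g ∘ suc) n
spread-cong k (suc r) f≗g (suc n) = spread-cong k r f≗g n

spread-agree : ∀ k r {f g} n → f ≗[≤ n ] g → spread k r f n ≡ spread k r g n
spread-agree k zero    zero    f≡g = f≡g 0 z≤n
spread-agree k (suc r) zero    f≡g = refl
spread-agree k zero    (suc n) f≡g = spread-agree k k n (λ i i≤n → f≡g (suc i) (s≤s i≤n))
spread-agree k (suc r) (suc n) f≡g = spread-agree k r n (λ i i≤n → f≡g i (m≤n⇒m≤1+n i≤n))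

spread-⊕ : ∀ k r f g → spread k r (f ⊕ g) ≗ spread k r f ⊕ spread k r g
spread-⊕ k zero    f g zero    = refl
spread-⊕ k (suc r) f g zero    = refl
spread-⊕ k zero    f g (suc n) = spread-⊕ k k (tail f) (tail g) n
spread-⊕ k (suc r) f g (suc n) = spread-⊕ k r f g n

spread-• : ∀ k r c f → spread k r (c • f) ≗ c • spread k r f
spread-• k zero    c f zero    = refl
spread-• k (suc r) c f zero    = sym (*-zeroʳ c)
spread-• k zero    c f (suc n) = spread-• k k c (tail f) n
spread-• k (suc r) c f (suc n) = spread-• k r c f n

spread-𝟘 : ∀ k r → spread k r 𝟘 ≗ 𝟘
spread-𝟘 k zero    zero    = refl
spread-𝟘 k (suc r) zero    = refl
spread-𝟘 k zero    (suc n) = spread-𝟘 k k n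
spread-𝟘 k (suc r) (suc n) = spread-𝟘 k r n

dilate-unfold : ∀ k .{{_ : NonZero k}} f → dilate k f ≗ f 0 • 𝟙 ⊕ shift k (dilate k (tail f))
dilate-unfold (suc k) f zero    = sym (trans (+-identityʳ _) (*-identityʳ (f 0)))
dilate-unfold (suc k) f (suc n) =
  trans (spread-shift k k (tail f) n) (cong (_+ shift k (spread k 0 (tail f)) n) (sym (*-zeroʳ (f 0))))

dilate-at-+ : ∀ k .{{_ : NonZero k}} f n → dilate k f (k + n) ≡ dilate k (tail f) n
dilate-at-+ (suc k) f n =
  trans (dilate-unfold (suc k) f (suc k + n)) (cong₂ _+_ (*-zeroʳ (f 0)) (shift-at (suc k) _ n))

dilate-cong : ∀ k .{{_ : NonZero k}} {f g} → f ≗ g → dilate k f ≗ dilate k g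
dilate-cong (suc k) = spread-cong k 0

dilate-agree : ∀ k .{{_ : NonZero k}} {f g} n → f ≗[≤ n ] g → dilate k f ≗[≤ n ] dilate k g
dilate-agree (suc k) n f≡g i i≤n = spread-agree k 0 i (λ j j≤i → f≡g j (≤-trans j≤i i≤n))

dilate-⊕ : ∀ k .{{_ : NonZero k}} f g → dilate k (f ⊕ g) ≗ dilate k f ⊕ dilate k g
dilate-⊕ (suc k) = spread-⊕ k 0

dilate-• : ∀ k .{{_ : NonZero k}} c f → dilate k (c • f) ≗ c • dilate k f
dilate-• (suc k) = spread-• k 0

dilate-𝟙 : ∀ k .{{_ : NonZero k}} → dilate k 𝟙 ≗ 𝟙
dilate-𝟙 (suc k) zero    = refl
dilate-𝟙 (suc k) (suc n) = spread-𝟘 k k n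

dilate-shift₁ : ∀ k .{{_ : NonZero k}} f → dilate k (shift 1 f) ≗ shift k (dilate k f)
dilate-shift₁ (suc k) f zero    = refl
dilate-shift₁ (suc k) f (suc n) = spread-shift k k f n

dilate-shift : ∀ k .{{_ : NonZero k}} j f → dilate k (shift j f) ≗ shift (k * j) (dilate k f)
dilate-shift k zero    f n = cong (λ i → shift i (dilate k f) n) (sym (*-zeroʳ k))
dilate-shift k (suc j) f n = begin
  dilate k (shift (suc j) f) n             ≡⟨ dilate-cong k (shift-+ 1 j f) n ⟩
  dilate k (shift 1 (shift j f)) n         ≡⟨ dilate-shift₁ k (shift j f) n ⟩
  shift k (dilate k (shift j f)) n         ≡⟨ shift-cong k (dilate-shift k j f) n ⟩
  shift k (shift (k * j) (dilate k f)) n   ≡⟨ shift-+ k (k * j) (dilate k f) n ⟨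
  shift (k + k * j) (dilate k f) n         ≡⟨ cong (λ i → shift i (dilate k f) n) (*-suc k j) ⟨
  shift (k * suc j) (dilate k f) n         ∎
  where open ≡-Reasoning

dilate-⊗ : ∀ k .{{_ : NonZero k}} f g → dilate k (f ⊗ g) ≗ dilate k f ⊗ dilate k g
dilate-⊗ k f g n = <-rec (λ n → ∀ f → dilate k (f ⊗ g) n ≡ (dilate k f ⊗ G) n) step n f
  where
  G = dilate k g
  step : ∀ n → (∀ {m} → m < n → ∀ f → dilate k (f ⊗ g) m ≡ (dilate k f ⊗ G) m) →
         ∀ f → dilate k (f ⊗ g) n ≡ (dilate k f ⊗ G) n
  step n rec f = begin
    dilate k (f ⊗ g) n
      ≡⟨ dilate-cong k (⊗-unfoldˡ f g) n ⟩
    dilate k (f 0 • g ⊕ shift 1 (tail f ⊗ g)) n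
      ≡⟨ dilate-⊕ k (f 0 • g) _ n ⟩
    dilate k (f 0 • g) n + dilate k (shift 1 (tail f ⊗ g)) n
      ≡⟨ cong₂ _+_ (dilate-• k (f 0) g n) (dilate-shift₁ k (tail f ⊗ g) n) ⟩
    f 0 * G n + shift k (dilate k (tail f ⊗ g)) n
      ≡⟨ cong (f 0 * G n +_) (shift-agree-below k n (λ m<n → rec m<n (tail f))) ⟩
    f 0 * G n + shift k (dilate k (tail f) ⊗ G) n
      ≡⟨ cong₂ _+_ (trans (•-⊗ (f 0) 𝟙 G n) (cong (f 0 *_) (⊗-identityˡ G n)))
                   (shift-⊗ˡ k (dilate k (tail f)) G n) ⟨
    (f 0 • 𝟙 ⊗ G) n + (shift k (dilate k (tail f)) ⊗ G) n
      ≡⟨ ⊗-distribʳ-⊕ G (f 0 • 𝟙) _ n ⟨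
    ((f 0 • 𝟙 ⊕ shift k (dilate k (tail f))) ⊗ G) n
      ≡⟨ ⊗-cong (dilate-unfold k f) (λ _ → refl) n ⟨
    (dilate k f ⊗ G) n
      ∎
    where open ≡-Reasoning

dilate-vanishes : ∀ k .{{_ : NonZero k}} f i r → 0 < r → r < k → dilate k f (i * k + r) ≡ 0
dilate-vanishes (suc k) f zero    (suc r) _ (s≤s r<k) = trans (spread-shift k k (tail f) r) (shift-below k _ r<k)
dilate-vanishes (suc k) f (suc i) r 0<r r<k =
  trans (cong (dilate (suc k) f) (+-assoc (suc k) (i * suc k) r))
        (trans (dilate-at-+ (suc k) f (i * suc k + r)) (dilate-vanishes (suc k) (tail f) i r 0<r r<k))

dilate-off-multiples : ∀ k .{{_ : NonZero k}} f {n} → ¬ k ∣ n → dilate k f n ≡ 0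
dilate-off-multiples k f {n} k∤n =
  trans (cong (dilate k f) n≡) (dilate-vanishes k f (n / k) (n % k) 0<n%k (m%n<n n k))
  where
  n≡ : n ≡ n / k * k + n % k
  n≡ = trans (m≡m%n+[m/n]*n n k) (+-comm (n % k) _)
  0<n%k : 0 < n % k
  0<n%k = n≢0⇒n>0 (λ n%k≡0 → k∤n (m%n≡0⇒n∣m n k n%k≡0))

geometric-unfold : ∀ k .{{_ : NonZero k}} → geometric k ≗ 𝟙 ⊕ shift k (geometric k)
geometric-unfold k n = trans (dilate-unfold k ones n) (cong (_+ shift k (geometric k) n) (*-identityˡ (𝟙 n)))

geometric-cong : ∀ {k l} .{{_ : NonZero k}} .{{_ : NonZero l}} → k ≡ l → geometric k ≗ geometric l
geometric-cong refl n = refl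

⊗-geometric : ∀ k .{{_ : NonZero k}} f → f ⊗ geometric k ≗ f ⊕ shift k (f ⊗ geometric k)
⊗-geometric k f n = begin
  (f ⊗ geometric k) n                         ≡⟨ ⊗-cong (λ _ → refl) (geometric-unfold k) n ⟩
  (f ⊗ (𝟙 ⊕ shift k (geometric k))) n         ≡⟨ ⊗-distribˡ-⊕ f 𝟙 _ n ⟩
  (f ⊗ 𝟙) n + (f ⊗ shift k (geometric k)) n   ≡⟨ cong₂ _+_ (⊗-identityʳ f n) (shift-⊗ʳ k f _ n) ⟩
  f n + shift k (f ⊗ geometric k) n           ∎
  where open ≡-Reasoning

dilate-geometric : ∀ m k .{{_ : NonZero m}} .{{_ : NonZero k}} →
                   dilate m (geometric k) ≗ geometric (m * k) {{m*n≢0 m k}}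
dilate-geometric m k = fixpoint-unique (m * k) 𝟙 dilated-unfold (geometric-unfold (m * k))
  where
  instance _ = m*n≢0 m k
  dilated-unfold : dilate m (geometric k) ≗ 𝟙 ⊕ shift (m * k) (dilate m (geometric k))
  dilated-unfold n = trans (dilate-cong m (geometric-unfold k) n)
    (trans (dilate-⊕ m 𝟙 _ n) (cong₂ _+_ (dilate-𝟙 m n) (dilate-shift m k (geometric k) n)))

-- Partition generating functions

partsAtMost : (ℕ → Bool) → ℕ → Series
partsAtMost allowed zero    = 𝟙
partsAtMost allowed (suc m) =
  if allowed (suc m) then partsAtMost allowed m ⊗ geometric (suc m) else partsAtMost allowed m

partsAtMost-zero : ∀ allowed m → partsAtMost allowed m 0 ≡ 1
partsAtMost-zero allowed zero    = refl
partsAtMost-zero allowed (suc m) with allowed (suc m)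
... | true  = cong (_* 1) (partsAtMost-zero allowed m)
... | false = partsAtMost-zero allowed m

partsAtMost-suc : ∀ allowed m n → partsAtMost allowed (suc m) n ≡
  partsAtMost allowed m n + (if allowed (suc m) then shift (suc m) (partsAtMost allowed (suc m)) n else 0)
partsAtMost-suc allowed m n with allowed (suc m)
... | true  = ⊗-geometric (suc m) (partsAtMost allowed m) n
... | false = sym (+-identityʳ _)

partsAtMost-allowed : ∀ allowed m → allowed (suc m) ≡ true →
                      partsAtMost allowed (suc m) ≗ partsAtMost allowed m ⊗ geometric (suc m)
partsAtMost-allowed allowed m allowed-m n rewrite allowed-m = refl

partsAtMost-skipped : ∀ allowed m → allowed (suc m) ≡ false →
                      partsAtMost allowed (suc m) ≗ partsAtMost allowed m
partsAtMost-skipped allowed m skipped-m n rewrite skipped-m = refl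

partsAtMost-stable : ∀ allowed → Stable (partsAtMost allowed)
partsAtMost-stable allowed {zero}  z≤n = refl
partsAtMost-stable allowed {suc m} {n} n≤1+m with m≤n⇒m<n∨m≡n n≤1+m
... | inj₂ refl = refl
... | inj₁ (s≤s n≤m) = begin
  partsAtMost allowed (suc m) n
    ≡⟨ partsAtMost-suc allowed m n ⟩
  partsAtMost allowed m n + new-parts (allowed (suc m))
    ≡⟨ cong (partsAtMost allowed m n +_) (no-new-parts (allowed (suc m))) ⟩
  partsAtMost allowed m n + 0
    ≡⟨ +-identityʳ _ ⟩
  partsAtMost allowed m n
    ≡⟨ partsAtMost-stable allowed n≤m ⟩
  partsAtMost allowed n n
    ∎
  where
  open ≡-Reasoning
  new-parts : Bool → ℕ
  new-parts b = if b then shift (suc m) (partsAtMost allowed (suc m)) n else 0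
  no-new-parts : ∀ b → new-parts b ≡ 0
  no-new-parts true  = shift-below (suc m) _ (s≤s n≤m)
  no-new-parts false = refl

regular : ℕ → ℕ → Bool
regular ℓ k = not (does (ℓ ∣? k))

regParts≡partsAtMost : ∀ ℓ f m n → n ≤ f → regParts ℓ f m n ≡ partsAtMost (regular ℓ) m n
regParts≡partsAtMost ℓ f       zero    zero    _ = refl
regParts≡partsAtMost ℓ f       zero    (suc n) _ = refl
regParts≡partsAtMost ℓ zero    (suc m) zero    _ = sym (partsAtMost-zero (regular ℓ) (suc m))
regParts≡partsAtMost ℓ (suc f) (suc m) n n≤1+f =
  trans (cong₂ _+_ (regParts≡partsAtMost ℓ (suc f) m n n≤1+f) (new-parts (ℓ ∣? suc m)))
        (sym (partsAtMost-suc (regular ℓ) m n))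
  where
  new-parts : ∀ d → (if does d ∨ does (suc n ≤? suc m) then 0 else regParts ℓ f (suc m) (n ∸ suc m))
                  ≡ (if not (does d) then shift (suc m) (partsAtMost (regular ℓ) (suc m)) n else 0)
  new-parts (yes _) = refl
  -- does (suc n ≤? suc m) computes to n <ᵇ suc m
  new-parts (no _) with n <ᵇ suc m in n<ᵇ1+m
  ... | true  = sym (shift-below (suc m) _ (<ᵇ⇒< n (suc m) (subst True (sym n<ᵇ1+m) _)))
  ... | false = begin
    regParts ℓ f (suc m) (n ∸ suc m)
      ≡⟨ regParts≡partsAtMost ℓ f (suc m) (n ∸ suc m) (≤-trans (∸-monoˡ-≤ (suc m) n≤1+f) (m∸n≤m f m)) ⟩
    partsAtMost (regular ℓ) (suc m) (n ∸ suc m)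
      ≡⟨ shift-at (suc m) _ (n ∸ suc m) ⟨
    shift (suc m) (partsAtMost (regular ℓ) (suc m)) (suc m + (n ∸ suc m))
      ≡⟨ cong (shift (suc m) _) (m+[n∸m]≡n 1+m≤n) ⟩
    shift (suc m) (partsAtMost (regular ℓ) (suc m)) n
      ∎
    where
    open ≡-Reasoning
    1+m≤n : suc m ≤ n
    1+m≤n = ≮⇒≥ (λ n<1+m → subst True n<ᵇ1+m (<⇒<ᵇ n<1+m))

regPart≡limit : ∀ ℓ → regPart ℓ ≗ limit (partsAtMost (regular ℓ))
regPart≡limit ℓ n = regParts≡partsAtMost ℓ n n n ≤-refl

sum-upTo≡⊗ : ∀ f g n → sum (map (λ a → f a * g (n ∸ a)) (upTo (suc n))) ≡ (f ⊗ g) n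
sum-upTo≡⊗ f g n = trans (cong sum (map-applyUpTo id _ (suc n))) (sum-applyUpTo f n)
  where
  sum-applyUpTo : ∀ f n → sum (applyUpTo (λ a → f a * g (n ∸ a)) (suc n)) ≡ (f ⊗ g) n
  sum-applyUpTo f zero    = +-identityʳ _
  sum-applyUpTo f (suc n) = cong (f 0 * g (suc n) +_) (sum-applyUpTo (tail f) n)

T-zero : ∀ ℓ → T ℓ 0 ≗ 𝟙
T-zero ℓ zero    = refl
T-zero ℓ (suc n) = refl

T-suc : ∀ ℓ k → T ℓ (suc k) ≗ regPart ℓ ⊗ T ℓ k
T-suc ℓ k = sum-upTo≡⊗ (regPart ℓ) (T ℓ k)

T₃≗cube : ∀ ℓ → T ℓ 3 ≗ regPart ℓ ⊗ (regPart ℓ ⊗ regPart ℓ)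
T₃≗cube ℓ = begin
  T ℓ 3                   ≈⟨ T-suc ℓ 2 ⟩
  A ⊗ T ℓ 2               ≈⟨ A⊗ (T-suc ℓ 1) ⟩
  A ⊗ (A ⊗ T ℓ 1)         ≈⟨ A⊗ (A⊗ (T-suc ℓ 0)) ⟩
  A ⊗ (A ⊗ (A ⊗ T ℓ 0))   ≈⟨ A⊗ (A⊗ (A⊗ (T-zero ℓ))) ⟩
  A ⊗ (A ⊗ (A ⊗ 𝟙))       ≈⟨ A⊗ (A⊗ (⊗-identityʳ A)) ⟩
  A ⊗ (A ⊗ A)             ∎
  where
  open ≗-Reasoning
  A = regPart ℓ
  A⊗ : ∀ {f g} → f ≗ g → A ⊗ f ≗ A ⊗ g
  A⊗ = ⊗-cong (λ _ → refl)

partitionsUpTo : ℕ → Series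
partitionsUpTo = partsAtMost (λ _ → true)

partitions : Series
partitions = limit partitionsUpTo

oddPartsUpTo : ℕ → Series
oddPartsUpTo = partsAtMost (regular 2)

odd-regular : ∀ j → regular 2 (suc (2 * j)) ≡ true
odd-regular j = cong not (dec-false (2 ∣? suc (2 * j)) 2∤1+2j)
  where
  2∤1+2j : ¬ 2 ∣ suc (2 * j)
  2∤1+2j 2∣1+2j = >⇒∤ (s≤s (s≤s z≤n)) (∣m+n∣m⇒∣n (subst (2 ∣_) (+-comm 1 (2 * j)) 2∣1+2j) (divides j (*-comm 2 j)))

even-irregular : ∀ j → regular 2 (suc (suc (2 * j))) ≡ false
even-irregular j = cong not (dec-true (2 ∣? suc (suc (2 * j))) (divides (suc j) 2+2j≡))
  where
  2+2j≡ : suc (suc (2 * j)) ≡ suc j * 2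
  2+2j≡ = trans (sym (*-suc 2 j)) (*-comm 2 (suc j))

mutual
  euler-even : ∀ j → partitionsUpTo (2 * j) ≗ oddPartsUpTo (2 * j) ⊗ dilate 2 (partitionsUpTo j)
  euler-even zero    n = sym (trans (⊗-identityˡ _ n) (dilate-𝟙 2 n))
  euler-even (suc j) n = begin
    partitionsUpTo (2 * suc j) n
      ≡⟨ cong (λ m → partitionsUpTo m n) (*-suc 2 j) ⟩
    (partitionsUpTo (suc (2 * j)) ⊗ G) n
      ≡⟨ ⊗-cong (euler-odd j) (λ _ → refl) n ⟩
    (oddPartsUpTo (suc (2 * j)) ⊗ D ⊗ G) n
      ≡⟨ ⊗-assoc (oddPartsUpTo (suc (2 * j))) D G n ⟩
    (oddPartsUpTo (suc (2 * j)) ⊗ (D ⊗ G)) n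
      ≡⟨ ⊗-cong (partsAtMost-skipped (regular 2) (suc (2 * j)) (even-irregular j)) dilated n ⟨
    (oddPartsUpTo (2 + 2 * j) ⊗ dilate 2 (partitionsUpTo (suc j))) n
      ≡⟨ cong (λ m → (oddPartsUpTo m ⊗ dilate 2 (partitionsUpTo (suc j))) n) (*-suc 2 j) ⟨
    (oddPartsUpTo (2 * suc j) ⊗ dilate 2 (partitionsUpTo (suc j))) n
      ∎
    where
    open ≡-Reasoning
    D = dilate 2 (partitionsUpTo j)
    G = geometric (suc (suc (2 * j)))
    dilated : dilate 2 (partitionsUpTo (suc j)) ≗ D ⊗ G
    dilated i = trans (dilate-⊗ 2 (partitionsUpTo j) (geometric (suc j)) i)
      (⊗-cong (λ _ → refl) (λ i → trans (dilate-geometric 2 (suc j) i) (geometric-cong (*-suc 2 j) i)) i)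

  euler-odd : ∀ j → partitionsUpTo (suc (2 * j)) ≗ oddPartsUpTo (suc (2 * j)) ⊗ dilate 2 (partitionsUpTo j)
  euler-odd j n = begin
    (partitionsUpTo (2 * j) ⊗ G) n
      ≡⟨ ⊗-cong (euler-even j) (λ _ → refl) n ⟩
    (oddPartsUpTo (2 * j) ⊗ D ⊗ G) n
      ≡⟨ solve 3 (λ a d g → a :* d :* g := a :* g :* d) (λ _ → refl) (oddPartsUpTo (2 * j)) D G n ⟩
    (oddPartsUpTo (2 * j) ⊗ G ⊗ D) n
      ≡⟨ ⊗-cong (partsAtMost-allowed (regular 2) (2 * j) (odd-regular j)) (λ _ → refl) n ⟨
    (oddPartsUpTo (suc (2 * j)) ⊗ D) n
      ∎
    where
    open ≡-Reasoning
    D = dilate 2 (partitionsUpTo j)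
    G = geometric (suc (2 * j))

euler-factorisation : partitions ≗ regPart 2 ⊗ dilate 2 partitions
euler-factorisation n = begin
  partitionsUpTo n n
    ≡⟨ partsAtMost-stable _ n≤2n ⟨
  partitionsUpTo (2 * n) n
    ≡⟨ euler-even n n ⟩
  (oddPartsUpTo (2 * n) ⊗ dilate 2 (partitionsUpTo n)) n
    ≡⟨ ⊗-agree n odd≡regular dilated-agree ⟩
  (regPart 2 ⊗ dilate 2 partitions) n
    ∎
  where
  open ≡-Reasoning
  n≤2n : n ≤ 2 * n
  n≤2n = m≤n*m n 2
  odd≡regular : oddPartsUpTo (2 * n) ≗[≤ n ] regPart 2
  odd≡regular i i≤n = trans (partsAtMost-stable _ (≤-trans i≤n n≤2n)) (sym (regPart≡limit 2 i))
  dilated-agree : dilate 2 (partitionsUpTo n) ≗[≤ n ] dilate 2 partitions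
  dilated-agree i i≤n = sym (dilate-agree 2 n (limit-agree (partsAtMost-stable _) ≤-refl) i i≤n)

1+q^_ : ℕ → Series
1+q^ k = 𝟙 ⊕ shift k 𝟙

distinctPartsUpTo : ℕ → Series
distinctPartsUpTo zero    = 𝟙
distinctPartsUpTo (suc m) = distinctPartsUpTo m ⊗ 1+q^ (suc m)

distinctParts : Series
distinctParts = limit distinctPartsUpTo

⊗-1+q^ : ∀ k f → f ⊗ 1+q^ k ≗ f ⊕ shift k f
⊗-1+q^ k f n = trans (⊗-distribˡ-⊕ f 𝟙 (shift k 𝟙) n) (cong₂ _+_ (⊗-identityʳ f n) (⊗-shift-𝟙 k f n))

distinctPartsUpTo-stable : Stable distinctPartsUpTo
distinctPartsUpTo-stable {zero}  z≤n = refl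
distinctPartsUpTo-stable {suc m} {n} n≤1+m with m≤n⇒m<n∨m≡n n≤1+m
... | inj₂ refl = refl
... | inj₁ (s≤s n≤m) =
  trans (⊗-1+q^ (suc m) (distinctPartsUpTo m) n)
        (trans (cong (distinctPartsUpTo m n +_) (shift-below (suc m) _ (s≤s n≤m)))
               (trans (+-identityʳ _) (distinctPartsUpTo-stable n≤m)))

1+q^-⊗-geometric : ∀ k .{{_ : NonZero k}} → 1+q^ k ⊗ geometric k ≗ 𝟙 ⊕ 2 • shift k (geometric k)
1+q^-⊗-geometric k n = begin
  (1+q^ k ⊗ G) n                       ≡⟨ ⊗-comm (1+q^ k) G n ⟩
  (G ⊗ 1+q^ k) n                       ≡⟨ ⊗-1+q^ k G n ⟩
  G n + shift k G n                    ≡⟨ cong (_+ shift k G n) (geometric-unfold k n) ⟩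
  𝟙 n + shift k G n + shift k G n      ≡⟨ +-assoc (𝟙 n) _ _ ⟩
  𝟙 n + (shift k G n + shift k G n)    ≡⟨ cong (λ x → 𝟙 n + (shift k G n + x)) (+-identityʳ _) ⟨
  𝟙 n + 2 * shift k G n                ∎
  where
  open ≡-Reasoning
  G = geometric k

-- Congruences modulo m

infix 4 _≈_[mod_]
_≈_[mod_] : Series → Series → (m : ℕ) → .{{NonZero m}} → Set
f ≈ g [mod m ] = ∀ n → f n % m ≡ g n % m

≈-setoid : (m : ℕ) .{{_ : NonZero m}} → Setoid 0ℓ 0ℓ
≈-setoid m = record
  { _≈_ = λ f g → f ≈ g [mod m ]
  ; isEquivalence = record
    { refl = λ _ → refl ; sym = λ f≈g n → sym (f≈g n) ; trans = λ f≈g g≈h n → trans (f≈g n) (g≈h n) } }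

module ≈-Reasoning (m : ℕ) .{{_ : NonZero m}} = Relation.Binary.Reasoning.Setoid (≈-setoid m)

≗⇒≈ : ∀ m .{{_ : NonZero m}} {f g} → f ≗ g → f ≈ g [mod m ]
≗⇒≈ m f≗g n = cong (_% m) (f≗g n)

module _ {m : ℕ} .{{_ : NonZero m}} where

  +-cong-mod : ∀ {a b c d} → a % m ≡ b % m → c % m ≡ d % m → (a + c) % m ≡ (b + d) % m
  +-cong-mod {a} {b} {c} {d} a≡b c≡d =
    trans (%-distribˡ-+ a c m) (trans (cong₂ (λ x y → (x + y) % m) a≡b c≡d) (sym (%-distribˡ-+ b d m)))

  *-cong-mod : ∀ {a b c d} → a % m ≡ b % m → c % m ≡ d % m → (a * c) % m ≡ (b * d) % m
  *-cong-mod {a} {b} {c} {d} a≡b c≡d =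
    trans (%-distribˡ-* a c m) (trans (cong₂ (λ x y → (x * y) % m) a≡b c≡d) (sym (%-distribˡ-* b d m)))

  ⊗-cong-mod : ∀ {f f' g g'} → f ≈ f' [mod m ] → g ≈ g' [mod m ] → f ⊗ g ≈ f' ⊗ g' [mod m ]
  ⊗-cong-mod f≈f' g≈g' n =
    ⊗-respects {λ a b → a % m ≡ b % m} +-cong-mod *-cong-mod n (λ i _ → f≈f' i) (λ i _ → g≈g' i)

  ⊕-multiple : ∀ f g → f ⊕ m • g ≈ f [mod m ]
  ⊕-multiple f g n = %-remove-+ʳ (f n) (m∣m*n (g n))

fermat₂ : ∀ x → (x * x) % 2 ≡ x % 2
fermat₂ x = trans (%-distribˡ-* x x 2) (residue (x % 2) (m%n<n x 2))
  where
  residue : ∀ r → r < 2 → (r * r) % 2 ≡ r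
  residue 0 _ = refl
  residue 1 _ = refl
  residue (suc (suc _)) (s≤s (s≤s ()))

fermat₃ : ∀ x → (x * (x * x)) % 3 ≡ x % 3
fermat₃ x = begin
  (x * (x * x)) % 3                           ≡⟨ %-distribˡ-* x (x * x) 3 ⟩
  (x % 3 * ((x * x) % 3)) % 3                 ≡⟨ cong (λ y → (x % 3 * y) % 3) (%-distribˡ-* x x 3) ⟩
  (x % 3 * ((x % 3 * (x % 3)) % 3)) % 3       ≡⟨ residue (x % 3) (m%n<n x 3) ⟩
  x % 3                                       ∎
  where
  open ≡-Reasoning
  residue : ∀ r → r < 3 → (r * ((r * r) % 3)) % 3 ≡ r
  residue 0 _ = refl
  residue 1 _ = refl
  residue 2 _ = refl
  residue (suc (suc (suc _))) (s≤s (s≤s (s≤s ())))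

square-mod₂ : ∀ f → f ⊗ f ≈ (f 0 * f 0) • 𝟙 ⊕ shift 2 (tail f ⊗ tail f) [mod 2 ]
square-mod₂ f = begin
  f ⊗ f
    ≈⟨ ≗⇒≈ 2 (⊗-cong (decompose f) (decompose f)) ⟩
  (C ⊕ Y) ⊗ (C ⊕ Y)
    ≈⟨ ≗⇒≈ 2 (solve 2 (λ C Y → (C :+ Y) :* (C :+ Y) := C :* C :+ Y :* Y :+ (C :* Y :+ C :* Y)) (λ _ → refl) C Y) ⟩
  C ⊗ C ⊕ Y ⊗ Y ⊕ (C ⊗ Y ⊕ C ⊗ Y)
    ≈⟨ ≗⇒≈ 2 (⊕-cong {C ⊗ C ⊕ Y ⊗ Y} (λ _ → refl) twice) ⟩
  C ⊗ C ⊕ Y ⊗ Y ⊕ 2 • (C ⊗ Y)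
    ≈⟨ ⊕-multiple (C ⊗ C ⊕ Y ⊗ Y) (C ⊗ Y) ⟩
  C ⊗ C ⊕ Y ⊗ Y
    ≈⟨ ≗⇒≈ 2 (⊕-cong (•𝟙-⊗ (f 0) (f 0)) (shift-⊗-shift 1 1 (tail f) (tail f))) ⟩
  (f 0 * f 0) • 𝟙 ⊕ shift 2 (tail f ⊗ tail f)
    ∎
  where
  open ≈-Reasoning 2
  C = f 0 • 𝟙
  Y = shift 1 (tail f)
  twice : C ⊗ Y ⊕ C ⊗ Y ≗ 2 • (C ⊗ Y)
  twice n = cong ((C ⊗ Y) n +_) (sym (+-identityʳ _))

cube-mod₃ : ∀ f → f ⊗ (f ⊗ f) ≈ (f 0 * (f 0 * f 0)) • 𝟙 ⊕ shift 3 (tail f ⊗ (tail f ⊗ tail f)) [mod 3 ]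
cube-mod₃ f = begin
  f ⊗ (f ⊗ f)
    ≈⟨ ≗⇒≈ 3 (⊗-cong (decompose f) (⊗-cong (decompose f) (decompose f))) ⟩
  (C ⊕ Y) ⊗ ((C ⊕ Y) ⊗ (C ⊕ Y))
    ≈⟨ ≗⇒≈ 3 (solve 2 (λ C Y → (C :+ Y) :* ((C :+ Y) :* (C :+ Y)) :=
                               C :* (C :* C) :+ Y :* (Y :* Y) :+
                               (C :* Y :* (C :+ Y) :+ C :* Y :* (C :+ Y) :+ C :* Y :* (C :+ Y)))
                      (λ _ → refl) C Y) ⟩
  C ⊗ (C ⊗ C) ⊕ Y ⊗ (Y ⊗ Y) ⊕ (Z ⊕ Z ⊕ Z)
    ≈⟨ ≗⇒≈ 3 (⊕-cong {C ⊗ (C ⊗ C) ⊕ Y ⊗ (Y ⊗ Y)} (λ _ → refl) thrice) ⟩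
  C ⊗ (C ⊗ C) ⊕ Y ⊗ (Y ⊗ Y) ⊕ 3 • Z
    ≈⟨ ⊕-multiple (C ⊗ (C ⊗ C) ⊕ Y ⊗ (Y ⊗ Y)) Z ⟩
  C ⊗ (C ⊗ C) ⊕ Y ⊗ (Y ⊗ Y)
    ≈⟨ ≗⇒≈ 3 (⊕-cong cubeC cubeY) ⟩
  (f 0 * (f 0 * f 0)) • 𝟙 ⊕ shift 3 (tail f ⊗ (tail f ⊗ tail f))
    ∎
  where
  open ≈-Reasoning 3
  C = f 0 • 𝟙
  Y = shift 1 (tail f)
  Z = C ⊗ Y ⊗ (C ⊕ Y)
  thrice : Z ⊕ Z ⊕ Z ≗ 3 • Z
  thrice n = triple (Z n)
    where
    triple : ∀ x → x + x + x ≡ 3 * x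
    triple = solve-∀
  cubeC : C ⊗ (C ⊗ C) ≗ (f 0 * (f 0 * f 0)) • 𝟙
  cubeC n = trans (⊗-cong (λ _ → refl) (•𝟙-⊗ (f 0) (f 0)) n) (•𝟙-⊗ (f 0) (f 0 * f 0) n)
  cubeY : Y ⊗ (Y ⊗ Y) ≗ shift 3 (tail f ⊗ (tail f ⊗ tail f))
  cubeY n = trans (⊗-cong (λ _ → refl) (shift-⊗-shift 1 1 (tail f) (tail f)) n) (shift-⊗-shift 1 2 (tail f) _ n)

•𝟙-⊕-zero : ∀ c h → h 0 ≡ 0 → (c • 𝟙 ⊕ h) 0 ≡ c
•𝟙-⊕-zero c h h0≡0 = trans (cong (c * 1 +_) h0≡0) (trans (+-identityʳ _) (*-identityʳ c))

•𝟙-⊕-suc : ∀ c h n → (c • 𝟙 ⊕ h) (suc n) ≡ h (suc n)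
•𝟙-⊕-suc c h n = cong (_+ h (suc n)) (*-zeroʳ c)

frobenius₂ : ∀ f → f ⊗ f ≈ dilate 2 f [mod 2 ]
frobenius₂ f zero    = trans (square-mod₂ f 0) (trans (cong (_% 2) (•𝟙-⊕-zero (f 0 * f 0) H refl)) (fermat₂ (f 0)))
  where H = shift 2 (tail f ⊗ tail f)
frobenius₂ f (suc n) = trans (square-mod₂ f (suc n)) (trans (cong (_% 2) (•𝟙-⊕-suc (f 0 * f 0) H n)) (higher n))
  where
  H = shift 2 (tail f ⊗ tail f)
  higher : ∀ n → H (suc n) % 2 ≡ dilate 2 f (suc n) % 2
  higher zero    = refl
  higher (suc n) = frobenius₂ (tail f) n

frobenius₃ : ∀ f → f ⊗ (f ⊗ f) ≈ dilate 3 f [mod 3 ]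
frobenius₃ f zero    =
  trans (cube-mod₃ f 0) (trans (cong (_% 3) (•𝟙-⊕-zero (f 0 * (f 0 * f 0)) H refl)) (fermat₃ (f 0)))
  where H = shift 3 (tail f ⊗ (tail f ⊗ tail f))
frobenius₃ f (suc n) =
  trans (cube-mod₃ f (suc n)) (trans (cong (_% 3) (•𝟙-⊕-suc (f 0 * (f 0 * f 0)) H n)) (higher n))
  where
  H = shift 3 (tail f ⊗ (tail f ⊗ tail f))
  higher : ∀ n → H (suc n) % 3 ≡ dilate 3 f (suc n) % 3
  higher zero          = refl
  higher (suc zero)    = refl
  higher (suc (suc n)) = frobenius₃ (tail f) n

distinct⊗partitions-upTo : ∀ m → distinctPartsUpTo m ⊗ partitionsUpTo m ≈ 𝟙 [mod 2 ]
distinct⊗partitions-upTo zero    = ≗⇒≈ 2 (⊗-identityˡ 𝟙)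
distinct⊗partitions-upTo (suc m) = begin
  (Q ⊗ B) ⊗ (P ⊗ G)
    ≈⟨ ≗⇒≈ 2 (solve 4 (λ Q B P G → (Q :* B) :* (P :* G) := (Q :* P) :* (B :* G)) (λ _ → refl) Q B P G) ⟩
  (Q ⊗ P) ⊗ (B ⊗ G)
    ≈⟨ ⊗-cong-mod (distinct⊗partitions-upTo m) (≗⇒≈ 2 (1+q^-⊗-geometric (suc m))) ⟩
  𝟙 ⊗ (𝟙 ⊕ 2 • shift (suc m) G)
    ≈⟨ ≗⇒≈ 2 (⊗-identityˡ _) ⟩
  𝟙 ⊕ 2 • shift (suc m) G
    ≈⟨ ⊕-multiple 𝟙 (shift (suc m) G) ⟩
  𝟙
    ∎
  where
  open ≈-Reasoning 2
  Q = distinctPartsUpTo m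
  B = 1+q^ (suc m)
  P = partitionsUpTo m
  G = geometric (suc m)

distinct⊗partitions : distinctParts ⊗ partitions ≈ 𝟙 [mod 2 ]
distinct⊗partitions n = trans (cong (_% 2) agree) (distinct⊗partitions-upTo n n)
  where
  agree : (distinctParts ⊗ partitions) n ≡ (distinctPartsUpTo n ⊗ partitionsUpTo n) n
  agree = ⊗-agree n (limit-agree distinctPartsUpTo-stable ≤-refl) (limit-agree (partsAtMost-stable _) ≤-refl)

-- Gauss's identity from a finite Jacobi triple product

prev : (ℕ → Series) → ℕ → Series
prev h zero    = 𝟘
prev h (suc r) = h r

gaussian : ℕ → ℕ → Series
gaussian zero    zero    = 𝟙
gaussian zero    (suc r) = 𝟘
gaussian (suc M) zero    = 𝟙
gaussian (suc M) (suc r) = gaussian M r ⊕ shift (suc r) (gaussian M (suc r))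

gaussian-zero : ∀ M → gaussian M 0 ≗ 𝟙
gaussian-zero zero    n = refl
gaussian-zero (suc M) n = refl

gaussian-above : ∀ M r → M < r → gaussian M r ≗ 𝟘
gaussian-above zero    (suc r) _         n = refl
gaussian-above (suc M) (suc r) (s≤s M<r) n =
  cong₂ _+_ (gaussian-above M r M<r n)
            (trans (shift-cong (suc r) (gaussian-above M (suc r) (m≤n⇒m≤1+n M<r)) n) (shift-𝟘 (suc r) n))

gaussian-vanishes-or : ∀ M r → gaussian M r ≗ 𝟘 ⊎ r ≤ M
gaussian-vanishes-or M r with r ≤? M
... | yes r≤M = inj₂ r≤M
... | no  r≰M = inj₁ (gaussian-above M r (≰⇒> r≰M))

gaussian-pascal : ∀ M r → gaussian (suc M) (suc r) ≗ shift (M ∸ r) (gaussian M r) ⊕ gaussian M (suc r)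
gaussian-pascal zero    zero    n = cong (𝟙 n +_) (shift-𝟘 1 n)
gaussian-pascal zero    (suc r) n = shift-𝟘 (2 + r) n
gaussian-pascal (suc M) zero    n = begin
  𝟙 n + shift 1 (gaussian M 0 ⊕ shift 1 b) n
    ≡⟨ cong (𝟙 n +_) (shift-cong 1 (gaussian-pascal M 0) n) ⟩
  𝟙 n + shift 1 (shift M (gaussian M 0) ⊕ b) n
    ≡⟨ cong (𝟙 n +_) (shift-⊕ 1 (shift M (gaussian M 0)) b n) ⟩
  𝟙 n + (shift 1 (shift M (gaussian M 0)) n + shift 1 b n)
    ≡⟨ cong (λ x → 𝟙 n + (x + shift 1 b n)) (trans (sym (shift-+ 1 M _ n)) (shift-cong (suc M) (gaussian-zero M) n)) ⟩
  𝟙 n + (shift (suc M) 𝟙 n + shift 1 b n)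
    ≡⟨ exchange (𝟙 n) (shift (suc M) 𝟙 n) (shift 1 b n) ⟩
  shift (suc M) 𝟙 n + (𝟙 n + shift 1 b n)
    ≡⟨ cong (λ x → shift (suc M) 𝟙 n + (x + shift 1 b n)) (gaussian-zero M n) ⟨
  shift (suc M) 𝟙 n + gaussian (suc M) 1 n
    ∎
  where
  open ≡-Reasoning
  b = gaussian M 1
  exchange : ∀ x y z → x + (y + z) ≡ y + (x + z)
  exchange = solve-∀
gaussian-pascal (suc M) (suc r) n = begin
  (a ⊕ shift s b) n + shift (suc s) (gaussian (suc M) (suc s)) n
    ≡⟨ cong₂ _+_ (gaussian-pascal M r n) (shift-cong (suc s) (gaussian-pascal M s) n) ⟩
  (shift d a ⊕ b) n + shift (suc s) (shift (M ∸ s) b ⊕ c) n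
    ≡⟨ cong ((shift d a ⊕ b) n +_) (shift-⊕ (suc s) (shift (M ∸ s) b) c n) ⟩
  (shift d a n + b n) + (shift (suc s) (shift (M ∸ s) b) n + shift (suc s) c n)
    ≡⟨ cong (λ x → (shift d a n + b n) + (x + shift (suc s) c n)) (shift-shift-index (suc s) (M ∸ s) d s index n) ⟩
  (shift d a n + b n) + (shift d (shift s b) n + shift (suc s) c n)
    ≡⟨ exchange (shift d a n) (b n) _ _ ⟩
  (shift d a n + shift d (shift s b) n) + (b n + shift (suc s) c n)
    ≡⟨ cong (_+ (b n + shift (suc s) c n)) (shift-⊕ d a (shift s b) n) ⟨
  shift d (a ⊕ shift s b) n + gaussian (suc M) (suc s) n
    ∎
  where
  open ≡-Reasoning
  s = suc r
  d = M ∸ r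
  a = gaussian M r
  b = gaussian M s
  c = gaussian M (suc s)
  exchange : ∀ x y z w → (x + y) + (z + w) ≡ (x + z) + (y + w)
  exchange = solve-∀
  index : b ≗ 𝟘 ⊎ suc s + (M ∸ s) ≡ d + s
  index = [ inj₁ , inj₂ ∘ exponents ]′ (gaussian-vanishes-or M s)
    where
    exponents : s ≤ M → suc s + (M ∸ s) ≡ d + s
    exponents s≤M = trans (cong suc (m+[n∸m]≡n s≤M))
                          (sym (trans (+-suc d r) (cong suc (m∸n+n≡m (≤-trans (n≤1+n r) s≤M)))))

gaussian-pascal-prev : ∀ M r → gaussian (suc M) r ≗ shift (suc M ∸ r) (prev (gaussian M) r) ⊕ gaussian M r
gaussian-pascal-prev M zero    n = sym (cong₂ _+_ (shift-𝟘 (suc M) n) (gaussian-zero M n))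
gaussian-pascal-prev M (suc r) = gaussian-pascal M r

gaussian-stable : ∀ M r m → m + r ≤ M → gaussian M r m ≡ partitionsUpTo r m
gaussian-stable M       zero    m _ = gaussian-zero M m
gaussian-stable zero    (suc r) m m+r≤0 with subst (_≤ 0) (+-suc m r) m+r≤0
... | ()
gaussian-stable (suc M) (suc r) m m+1+r≤1+M = begin
  gaussian M r m + shift (suc r) (gaussian M (suc r)) m
    ≡⟨ cong₂ _+_ (gaussian-stable M r m m+r≤M) (shift-agree (suc r) m higher) ⟩
  partitionsUpTo r m + shift (suc r) (partitionsUpTo (suc r)) m
    ≡⟨ partsAtMost-suc (λ _ → true) r m ⟨
  partitionsUpTo (suc r) m
    ∎
  where
  open ≡-Reasoning
  m+r≤M : m + r ≤ M
  m+r≤M = ≤-pred (subst (_≤ suc M) (+-suc m r) m+1+r≤1+M)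
  higher : ∀ i → suc r + i ≡ m → gaussian M (suc r) i ≡ partitionsUpTo (suc r) i
  higher i 1+r+i≡m =
    gaussian-stable M (suc r) i (subst (_≤ M) (sym (trans (+-comm i (suc r)) 1+r+i≡m)) (≤-trans (m≤m+n m r) m+r≤M))

triangle : ℕ → ℕ
triangle zero    = zero
triangle (suc k) = triangle k + suc k

triangle-≥ : ∀ k → k ≤ triangle k
triangle-≥ zero    = z≤n
triangle-≥ (suc k) = m≤n+m (suc k) (triangle k)

triangle-pred : ∀ n → n + triangle (n ∸ 1) ≡ triangle n
triangle-pred zero    = refl
triangle-pred (suc n) = +-comm (suc n) (triangle n)

-- (r − n)(r − n + 1)/2 computed in ℕ: at most one of the two summands is nonzero.
jacobiExponent : ℕ → ℕ → ℕ
jacobiExponent n r = triangle (r ∸ n) + triangle (n ∸ suc r)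

jacobiExponent-zero : ∀ n → n + jacobiExponent n 0 ≡ triangle n
jacobiExponent-zero n = trans (cong (λ i → n + (triangle i + triangle (n ∸ 1))) (0∸n≡0 n)) (triangle-pred n)

jacobiExponent-suc : ∀ n r → n + jacobiExponent n (suc r) ≡ jacobiExponent n r + suc r
jacobiExponent-suc zero    r       = trans (+-identityʳ _) (cong (_+ suc r) (sym (+-identityʳ (triangle r))))
jacobiExponent-suc (suc n) zero    = trans (cong suc (jacobiExponent-zero n)) (+-comm 1 (triangle n))
jacobiExponent-suc (suc n) (suc r) =
  trans (cong suc (jacobiExponent-suc n r)) (sym (+-suc (jacobiExponent n r) (suc r)))

jacobiExponent-prev : ∀ n r → r ≤ n + n → suc n + jacobiExponent n r ≡ jacobiExponent n (suc r) + (n + n ∸ r)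
jacobiExponent-prev n r r≤2n = +-cancelˡ-≡ r _ _ (begin
  r + (suc n + e)          ≡⟨ rearrange₁ r n e ⟩
  n + (e + suc r)          ≡⟨ cong (n +_) (jacobiExponent-suc n r) ⟨
  n + (n + e')             ≡⟨ +-assoc n n e' ⟨
  n + n + e'               ≡⟨ cong (_+ e') (m+[n∸m]≡n r≤2n) ⟨
  r + (n + n ∸ r) + e'     ≡⟨ rearrange₂ r (n + n ∸ r) e' ⟩
  r + (e' + (n + n ∸ r))   ∎)
  where
  open ≡-Reasoning
  e  = jacobiExponent n r
  e' = jacobiExponent n (suc r)
  rearrange₁ : ∀ r n e → r + (suc n + e) ≡ n + (e + suc r)
  rearrange₁ = solve-∀
  rearrange₂ : ∀ r d e' → r + d + e' ≡ r + (e' + d)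
  rearrange₂ = solve-∀

-- jacobiCoeff n r is the coefficient of z^(r − n) in ∏_{k=1}^{n} (1 + z q^k)(1 + z⁻¹ q^(k−1)); the step
-- from n to n + 1 multiplies by (1 + z⁻¹ qⁿ)(1 + z q^(n+1)) = 1 + z⁻¹ qⁿ + z q^(n+1) + q^(2n+1).
jacobiCoeff : ℕ → ℕ → Series
jacobiCoeff zero    zero    = 𝟙
jacobiCoeff zero    (suc r) = 𝟘
jacobiCoeff (suc n) r =
  shift n (coeff r) ⊕ (prev coeff r ⊕ shift (suc (n + n)) (prev coeff r)) ⊕ shift (suc n) (prev (prev coeff) r)
  where coeff = jacobiCoeff n

shift-collect : ∀ e s X Y Z W →
  shift e (shift s X) ⊕ (shift e Y ⊕ shift e (shift s Z)) ⊕ shift e W ≗ shift e ((W ⊕ Y) ⊕ shift s (Z ⊕ X))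
shift-collect e s X Y Z W n = begin
  x + (y + z) + w                                    ≡⟨ rearrange x y z w ⟩
  (w + y) + (z + x)                                  ≡⟨ cong ((w + y) +_) (shift-⊕ e (shift s Z) (shift s X) n) ⟨
  (w + y) + shift e (shift s Z ⊕ shift s X) n        ≡⟨ cong₂ _+_ (shift-⊕ e W Y n) (shift-cong e (shift-⊕ s Z X) n) ⟨
  shift e (W ⊕ Y) n + shift e (shift s (Z ⊕ X)) n    ≡⟨ shift-⊕ e (W ⊕ Y) _ n ⟨
  shift e ((W ⊕ Y) ⊕ shift s (Z ⊕ X)) n              ∎
  where
  open ≡-Reasoning
  x = shift e (shift s X) n
  y = shift e Y n
  z = shift e (shift s Z) n
  w = shift e W n
  rearrange : ∀ x y z w → x + (y + z) + w ≡ (w + y) + (z + x)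
  rearrange = solve-∀

jacobiTerm : ℕ → ℕ → Series
jacobiTerm n r = shift (jacobiExponent n r) (gaussian (n + n) r)

jacobiTerm-step : ∀ n r →
  shift n (jacobiTerm n (suc r)) ⊕ (jacobiTerm n r ⊕ shift (suc (n + n)) (jacobiTerm n r))
    ⊕ shift (suc n) (prev (jacobiTerm n) r)
  ≗ jacobiTerm (suc n) (suc r)
jacobiTerm-step n r = begin
  shift n (shift (jacobiExponent n (suc r)) C) ⊕ (shift E B ⊕ shift (suc M) (shift E B))
    ⊕ shift (suc n) (prev (jacobiTerm n) r)
    ≈⟨ ⊕-cong (⊕-cong C-exponent (⊕-cong (λ _ → refl) B-exponent)) (A-exponent r) ⟩
  shift E (shift (suc r) C) ⊕ (shift E B ⊕ shift E (shift (suc r) (shift (M ∸ r) B))) ⊕ shift E (shift (suc M ∸ r) A)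
    ≈⟨ shift-collect E (suc r) C B (shift (M ∸ r) B) (shift (suc M ∸ r) A) ⟩
  shift E ((shift (suc M ∸ r) A ⊕ B) ⊕ shift (suc r) (shift (M ∸ r) B ⊕ C))
    ≈⟨ shift-cong E (λ i → cong₂ _+_ (gaussian-pascal-prev M r i) (shift-cong (suc r) (gaussian-pascal M r) i)) ⟨
  shift E (gaussian (2 + M) (suc r))
    ≈⟨ shift-cong E (λ i → cong (λ M → gaussian M (suc r) i) (cong suc (+-suc n n))) ⟨
  shift E (gaussian (suc n + suc n) (suc r))
    ∎
  where
  open ≗-Reasoning
  M = n + n
  E = jacobiExponent n r
  A = prev (gaussian M) r
  B = gaussian M r
  C = gaussian M (suc r)
  C-exponent : shift n (shift (jacobiExponent n (suc r)) C) ≗ shift E (shift (suc r) C)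
  C-exponent = shift-shift-index n _ E (suc r) (inj₂ (jacobiExponent-suc n r))
  B-exponent : shift (suc M) (shift E B) ≗ shift E (shift (suc r) (shift (M ∸ r) B))
  B-exponent i =
    trans (shift-shift-index (suc M) E E (suc r + (M ∸ r)) ([ inj₁ , inj₂ ∘ exponents ]′ (gaussian-vanishes-or M r)) i)
          (shift-cong E (shift-+ (suc r) (M ∸ r) B) i)
    where
    exponents : r ≤ M → suc M + E ≡ E + (suc r + (M ∸ r))
    exponents r≤M = trans (+-comm (suc M) E) (cong (λ x → E + suc x) (sym (m+[n∸m]≡n r≤M)))
  A-exponent : ∀ r → shift (suc n) (prev (jacobiTerm n) r)
                   ≗ shift (jacobiExponent n r) (shift (suc M ∸ r) (prev (gaussian M) r))
  A-exponent zero    i = trans (shift-𝟘 (suc n) i) (sym (trans (shift-cong E₀ (shift-𝟘 (suc M)) i) (shift-𝟘 E₀ i)))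
    where E₀ = jacobiExponent n 0
  A-exponent (suc r) = shift-shift-index (suc n) (jacobiExponent n r) (jacobiExponent n (suc r)) (M ∸ r)
    ([ inj₁ , inj₂ ∘ jacobiExponent-prev n r ]′ (gaussian-vanishes-or M r))

jacobiCoeff≗jacobiTerm : ∀ n r → jacobiCoeff n r ≗ jacobiTerm n r
jacobiCoeff≗jacobiTerm zero    zero    i = refl
jacobiCoeff≗jacobiTerm zero    (suc r) i = sym (shift-𝟘 (jacobiExponent 0 (suc r)) i)
jacobiCoeff≗jacobiTerm (suc n) zero      = begin
  shift n (jacobiCoeff n 0) ⊕ (𝟘 ⊕ shift (suc M) 𝟘) ⊕ shift (suc n) 𝟘
    ≈⟨ (λ i → trans (cong₂ (λ x y → shift n (jacobiCoeff n 0) i + (0 + x) + y)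
                           (shift-𝟘 (suc M) i) (shift-𝟘 (suc n) i))
                    (trans (+-identityʳ _) (+-identityʳ _))) ⟩
  shift n (jacobiCoeff n 0)
    ≈⟨ shift-cong n (jacobiCoeff≗jacobiTerm n 0) ⟩
  shift n (shift (jacobiExponent n 0) (gaussian M 0))
    ≈⟨ shift-shift-index n (jacobiExponent n 0) (triangle n) 0
                         (inj₂ (trans (jacobiExponent-zero n) (sym (+-identityʳ _)))) ⟩
  shift (triangle n) (gaussian M 0)
    ≈⟨ shift-cong (triangle n) (λ i → trans (gaussian-zero M i) (sym (gaussian-zero (suc n + suc n) i))) ⟩
  shift (triangle n) (gaussian (suc n + suc n) 0)
    ∎
  where
  open ≗-Reasoning
  M = n + n
jacobiCoeff≗jacobiTerm (suc n) (suc r) i =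
  trans (⊕-cong (⊕-cong (shift-cong n (jacobiCoeff≗jacobiTerm n (suc r)))
                        (⊕-cong (jacobiCoeff≗jacobiTerm n r) (shift-cong (suc (n + n)) (jacobiCoeff≗jacobiTerm n r))))
                (shift-cong (suc n) (prev-closed r)) i)
        (jacobiTerm-step n r i)
  where
  prev-closed : ∀ r → prev (jacobiCoeff n) r ≗ prev (jacobiTerm n) r
  prev-closed zero    _ = refl
  prev-closed (suc r) = jacobiCoeff≗jacobiTerm n r

jacobiExponent-above : ∀ n k → jacobiExponent n (n + k) ≡ triangle k
jacobiExponent-above n k = trans (cong₂ (λ a b → triangle a + triangle b) (m+n∸m≡n n k) n∸[1+n+k]≡0) (+-identityʳ _)
  where
  n∸[1+n+k]≡0 : n ∸ suc (n + k) ≡ 0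
  n∸[1+n+k]≡0 = m≤n⇒m∸n≡0 (≤-trans (m≤m+n n k) (n≤1+n _))

jacobiExponent-below : ∀ r k → jacobiExponent (suc (r + k)) r ≡ triangle k
jacobiExponent-below r k = cong₂ (λ a b → triangle a + triangle b) r∸[1+r+k]≡0 (m+n∸m≡n r k)
  where
  r∸[1+r+k]≡0 : r ∸ suc (r + k) ≡ 0
  r∸[1+r+k]≡0 = m≤n⇒m∸n≡0 (≤-trans (m≤m+n r k) (n≤1+n _))

jacobiExponent-window : ∀ n r m → m + jacobiExponent n r < n → m ≤ r × m + r ≤ n + n
jacobiExponent-window n r m small with n ≤? r
... | yes n≤r = subst (λ r → m ≤ r × m + r ≤ n + n) n+k≡r (above (r ∸ n) (subst (λ e → m + e < n) e≡ small))
  where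
  n+k≡r : n + (r ∸ n) ≡ r
  n+k≡r = m+[n∸m]≡n n≤r
  e≡ : jacobiExponent n r ≡ triangle (r ∸ n)
  e≡ = trans (cong (jacobiExponent n) (sym n+k≡r)) (jacobiExponent-above n (r ∸ n))
  above : ∀ k → m + triangle k < n → m ≤ n + k × m + (n + k) ≤ n + n
  above k m+t<n = ≤-trans (m≤m+n m _) (≤-trans (<⇒≤ m+t<n) (m≤m+n n k)) , (begin
    m + (n + k)   ≡⟨ exchange m n k ⟩
    n + (m + k)   ≤⟨ +-monoʳ-≤ n (≤-trans (+-monoʳ-≤ m (triangle-≥ k)) (<⇒≤ m+t<n)) ⟩
    n + n         ∎)
    where
    open ≤-Reasoning
    exchange : ∀ m n k → m + (n + k) ≡ n + (m + k)
    exchange = solve-∀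
... | no  n≰r = subst (λ n → m ≤ r × m + r ≤ n + n) 1+r+k≡n
                      (below (n ∸ suc r) (subst₂ (λ e n → m + e < n) e≡ (sym 1+r+k≡n) small))
  where
  1+r+k≡n : suc r + (n ∸ suc r) ≡ n
  1+r+k≡n = m+[n∸m]≡n (≰⇒> n≰r)
  e≡ : jacobiExponent n r ≡ triangle (n ∸ suc r)
  e≡ = trans (cong (λ n → jacobiExponent n r) (sym 1+r+k≡n)) (jacobiExponent-below r (n ∸ suc r))
  below : ∀ k → m + triangle k < suc (r + k) → m ≤ r × m + r ≤ suc (r + k) + suc (r + k)
  below k m+t<1+r+k = m≤r , +-mono-≤ (≤-trans m≤r r≤1+r+k) r≤1+r+k
    where
    m≤r : m ≤ r
    m≤r = +-cancelʳ-≤ k m r (≤-pred (≤-trans (s≤s (+-monoʳ-≤ m (triangle-≥ k))) m+t<1+r+k))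
    r≤1+r+k : r ≤ suc (r + k)
    r≤1+r+k = ≤-trans (m≤m+n r k) (n≤1+n _)

jacobiCoeff-above : ∀ n r → n + n < r → jacobiCoeff n r ≗ 𝟘
jacobiCoeff-above n r 2n<r i = trans (jacobiCoeff≗jacobiTerm n r i)
  (trans (shift-cong (jacobiExponent n r) (gaussian-above (n + n) r 2n<r) i) (shift-𝟘 (jacobiExponent n r) i))

jacobiCoeff-low : ∀ n r N → N < n → jacobiCoeff n r N ≡ shift (jacobiExponent n r) partitions N
jacobiCoeff-low n r N N<n = trans (jacobiCoeff≗jacobiTerm n r N) (shift-agree e N stable-part)
  where
  e = jacobiExponent n r
  stable-part : ∀ m → e + m ≡ N → gaussian (n + n) r m ≡ partitions m
  stable-part m e+m≡N with jacobiExponent-window n r m (subst (_< n) (sym (trans (+-comm m e) e+m≡N)) N<n)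
  ... | m≤r , m+r≤2n = trans (gaussian-stable (n + n) r m m+r≤2n) (partsAtMost-stable _ m≤r)

jacobiExponent-split : ∀ n (g : ℕ → Series) →
  ∑ (suc (n + n)) (g ∘ jacobiExponent n) ≗ ∑ (suc n) (g ∘ triangle) ⊕ ∑ n (g ∘ triangle)
jacobiExponent-split zero    g i = sym (+-identityʳ _)
jacobiExponent-split (suc n) g i = begin
  ∑ (suc (suc n + suc n)) (g ∘ jacobiExponent (suc n)) i
    ≡⟨ ∑-length (g ∘ jacobiExponent (suc n)) (cong (suc ∘ suc) (+-suc n n)) i ⟩
  g (triangle n) i + ∑ (suc (suc (n + n))) (g ∘ jacobiExponent n) i
    ≡⟨ cong (g (triangle n) i +_) (∑-snoc (suc (n + n)) (g ∘ jacobiExponent n) i) ⟩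
  g (triangle n) i + (∑ (suc (n + n)) (g ∘ jacobiExponent n) i + g (jacobiExponent n (suc (n + n))) i)
    ≡⟨ cong₂ (λ a b → g (triangle n) i + (a + b)) (jacobiExponent-split n g i) (cong (λ k → g k i) top) ⟩
  g (triangle n) i + (A (suc n) i + A n i + g (triangle (suc n)) i)
    ≡⟨ rearrange (g (triangle n) i) (A (suc n) i) (A n i) (g (triangle (suc n)) i) ⟩
  (A (suc n) i + g (triangle (suc n)) i) + (A n i + g (triangle n) i)
    ≡⟨ cong₂ _+_ (∑-snoc (suc n) (g ∘ triangle) i) (∑-snoc n (g ∘ triangle) i) ⟨
  A (suc (suc n)) i + A (suc n) i
    ∎
  where
  open ≡-Reasoning
  A : ℕ → Series
  A L = ∑ L (g ∘ triangle)
  rearrange : ∀ a b c d → a + (b + c + d) ≡ (b + d) + (c + a)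
  rearrange = solve-∀
  top : jacobiExponent n (suc (n + n)) ≡ triangle (suc n)
  top = trans (cong (jacobiExponent n) (sym (+-suc n n))) (jacobiExponent-above n (suc n))

jacobiSum : ℕ → Series
jacobiSum n = ∑ (suc (n + n)) (jacobiCoeff n)

jacobiSum-suc : ∀ n → jacobiSum (suc n) ≗
  shift n (jacobiSum n) ⊕ (jacobiSum n ⊕ shift (suc (n + n)) (jacobiSum n)) ⊕ shift (suc n) (jacobiSum n)
jacobiSum-suc n = begin
  ∑ (suc (suc n + suc n)) (jacobiCoeff (suc n))
    ≈⟨ ∑-length (jacobiCoeff (suc n)) (cong (suc ∘ suc) (+-suc n n)) ⟩
  ∑ L (λ r → h₁ r ⊕ (h₂ r ⊕ h₃ r) ⊕ h₄ r)
    ≈⟨ (λ i → trans (∑-⊕ L (λ r → h₁ r ⊕ (h₂ r ⊕ h₃ r)) h₄ i)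
                    (cong (_+ ∑ L h₄ i) (trans (∑-⊕ L h₁ (λ r → h₂ r ⊕ h₃ r) i)
                                               (cong (∑ L h₁ i +_) (∑-⊕ L h₂ h₃ i))))) ⟩
  ∑ L h₁ ⊕ (∑ L h₂ ⊕ ∑ L h₃) ⊕ ∑ L h₄
    ≈⟨ ⊕-cong (⊕-cong (∑-shift n L coeff) (⊕-cong (λ _ → refl) (∑-shift (suc M) L (prev coeff))))
              (∑-shift (suc n) L (prev (prev coeff))) ⟩
  shift n (∑ L coeff) ⊕ (∑ L (prev coeff) ⊕ shift (suc M) (∑ L (prev coeff)))
    ⊕ shift (suc n) (∑ L (prev (prev coeff)))
    ≈⟨ ⊕-cong (⊕-cong (shift-cong n drop₂) (⊕-cong drop₁ (shift-cong (suc M) drop₁))) (λ _ → refl) ⟩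
  shift n (jacobiSum n) ⊕ (jacobiSum n ⊕ shift (suc M) (jacobiSum n)) ⊕ shift (suc n) (jacobiSum n)
    ∎
  where
  open ≗-Reasoning
  M = n + n
  L = 3 + M
  coeff = jacobiCoeff n
  h₁ h₂ h₃ h₄ : ℕ → Series
  h₁ r = shift n (coeff r)
  h₂ r = prev coeff r
  h₃ r = shift (suc M) (prev coeff r)
  h₄ r = shift (suc n) (prev (prev coeff) r)
  beyond : ∀ k → coeff (suc k + M) ≗ 𝟘
  beyond k = jacobiCoeff-above n (suc k + M) (s≤s (m≤n+m M k))
  drop₁ : ∑ L (prev coeff) ≗ jacobiSum n
  drop₁ i = ∑-vanishing-last (suc M) coeff i (beyond 0 i)
  drop₂ : ∑ L coeff ≗ jacobiSum n
  drop₂ i = trans (∑-vanishing-last (2 + M) coeff i (beyond 1 i)) (drop₁ i)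

jacobiSum-step : ∀ n → jacobiSum (suc n) ≗ jacobiSum n ⊗ (1+q^ n ⊗ 1+q^ (suc n))
jacobiSum-step n = begin
  jacobiSum (suc n)
    ≈⟨ jacobiSum-suc n ⟩
  shift n σ ⊕ (σ ⊕ shift (suc (n + n)) σ) ⊕ shift (suc n) σ
    ≈⟨ ⊕-cong (⊕-cong (⊗-shift-𝟙 n σ) (⊕-cong (λ _ → refl) both)) (⊗-shift-𝟙 (suc n) σ) ⟨
  σ ⊗ u ⊕ (σ ⊕ σ ⊗ (u ⊗ v)) ⊕ σ ⊗ v
    ≈⟨ solve 3 (λ σ u v → σ :* ((con 1 :+ u) :* (con 1 :+ v)) := σ :* u :+ (σ :+ σ :* (u :* v)) :+ σ :* v)
               (λ _ → refl) σ u v ⟨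
  σ ⊗ (1+q^ n ⊗ 1+q^ (suc n))
    ∎
  where
  open ≗-Reasoning
  σ = jacobiSum n
  u = shift n 𝟙
  v = shift (suc n) 𝟙
  both : σ ⊗ (u ⊗ v) ≗ shift (suc (n + n)) σ
  both i = trans (⊗-cong (λ _ → refl) (shift-𝟙-⊗ n (suc n)) i)
                 (trans (⊗-shift-𝟙 (n + suc n) σ i) (cong (λ k → shift k σ i) (+-suc n n)))

jacobiSum-product : ∀ n → let D = distinctPartsUpTo (suc n) ⊗ distinctPartsUpTo n in jacobiSum (suc n) ≗ D ⊕ D
jacobiSum-product zero = begin
  jacobiSum 1                         ≈⟨ jacobiSum-step 0 ⟩
  jacobiSum 0 ⊗ (1+q^ 0 ⊗ 1+q^ 1)     ≈⟨ ⊗-cong (λ i → +-identityʳ (𝟙 i)) (λ _ → refl) ⟩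
  𝟙 ⊗ ((𝟙 ⊕ 𝟙) ⊗ 1+q^ 1)             ≈⟨ solve 1 (λ B → con 1 :* ((con 1 :+ con 1) :* B) :=
                                                      con 1 :* B :* con 1 :+ con 1 :* B :* con 1) (λ _ → refl) (1+q^ 1) ⟩
  𝟙 ⊗ 1+q^ 1 ⊗ 𝟙 ⊕ 𝟙 ⊗ 1+q^ 1 ⊗ 𝟙   ∎
  where open ≗-Reasoning
jacobiSum-product (suc n) = begin
  jacobiSum (2 + n)
    ≈⟨ jacobiSum-step (suc n) ⟩
  jacobiSum (suc n) ⊗ (B₁ ⊗ B₂)
    ≈⟨ ⊗-cong (jacobiSum-product n) (λ _ → refl) ⟩
  (Q ⊗ B₁ ⊗ Q ⊕ Q ⊗ B₁ ⊗ Q) ⊗ (B₁ ⊗ B₂)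
    ≈⟨ solve 3 (λ Q B₁ B₂ → (Q :* B₁ :* Q :+ Q :* B₁ :* Q) :* (B₁ :* B₂) :=
                            Q :* B₁ :* B₂ :* (Q :* B₁) :+ Q :* B₁ :* B₂ :* (Q :* B₁))
               (λ _ → refl) Q B₁ B₂ ⟩
  Q ⊗ B₁ ⊗ B₂ ⊗ (Q ⊗ B₁) ⊕ Q ⊗ B₁ ⊗ B₂ ⊗ (Q ⊗ B₁)
    ∎
  where
  open ≗-Reasoning
  Q = distinctPartsUpTo n
  B₁ = 1+q^ (suc n)
  B₂ = 1+q^ (2 + n)

triangularUpTo : ℕ → Series
triangularUpTo L = ∑ L (λ k → shift (triangle k) 𝟙)

triangular : Series
triangular = limit (triangularUpTo ∘ suc)

triangle-beyond : ∀ k f {n} → n < k → shift (triangle k) f n ≡ 0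
triangle-beyond k f n<k = shift-below (triangle k) f (≤-trans n<k (triangle-≥ k))

triangularUpTo-⊗ : ∀ L f → triangularUpTo L ⊗ f ≗ ∑ L (λ k → shift (triangle k) f)
triangularUpTo-⊗ L f n = trans (∑-⊗ L (λ k → shift (triangle k) 𝟙) f n)
  (∑-cong L (λ k i → trans (shift-⊗ˡ (triangle k) 𝟙 f i) (shift-cong (triangle k) (⊗-identityˡ f) i)) n)

triangularUpTo-stable : Stable (triangularUpTo ∘ suc)
triangularUpTo-stable {zero}  z≤n = refl
triangularUpTo-stable {suc m} {n} n≤1+m with m≤n⇒m<n∨m≡n n≤1+m
... | inj₂ refl = refl
... | inj₁ (s≤s n≤m) =
  trans (∑-vanishing-last (suc m) (λ k → shift (triangle k) 𝟙) n (triangle-beyond (suc m) 𝟙 (s≤s n≤m)))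
        (triangularUpTo-stable n≤m)

triangular-off : ∀ n → (∀ k → triangle k ≢ n) → triangular n ≡ 0
triangular-off n not-triangle =
  ∑-vanishes-at (suc n) (λ k → shift (triangle k) 𝟙) n (λ k → shift-𝟙-off (triangle k) (not-triangle k))

jacobiSum-low : ∀ n N → N ≤ n → jacobiSum (suc n) N ≡ 2 * (triangularUpTo (suc n) ⊗ partitions) N
jacobiSum-low n N N≤n = begin
  jacobiSum (suc n) N
    ≡⟨ ∑-cong-at L {jacobiCoeff (suc n)} {g ∘ jacobiExponent (suc n)} N
                 (λ r → jacobiCoeff-low (suc n) r N (s≤s N≤n)) ⟩
  ∑ L (g ∘ jacobiExponent (suc n)) N
    ≡⟨ jacobiExponent-split (suc n) g N ⟩
  ∑ (suc (suc n)) (g ∘ triangle) N + S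
    ≡⟨ cong (_+ S) (∑-snoc (suc n) (g ∘ triangle) N) ⟩
  S + g (triangle (suc n)) N + S
    ≡⟨ cong (λ x → S + x + S) (triangle-beyond (suc n) partitions (s≤s N≤n)) ⟩
  S + 0 + S
    ≡⟨ double S ⟩
  2 * S
    ≡⟨ cong (2 *_) (triangularUpTo-⊗ (suc n) partitions N) ⟨
  2 * (triangularUpTo (suc n) ⊗ partitions) N
    ∎
  where
  open ≡-Reasoning
  L = suc (suc n + suc n)
  g : ℕ → Series
  g k = shift k partitions
  S = ∑ (suc n) (g ∘ triangle) N
  double : ∀ x → x + 0 + x ≡ 2 * x
  double = solve-∀

gauss-identity-upTo : ∀ n N → N ≤ n →
  (distinctPartsUpTo (suc n) ⊗ distinctPartsUpTo n) N ≡ (triangularUpTo (suc n) ⊗ partitions) N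
gauss-identity-upTo n N N≤n = *-cancelˡ-≡ _ _ 2 (begin
  2 * D N                                       ≡⟨ cong (D N +_) (+-identityʳ (D N)) ⟩
  D N + D N                                     ≡⟨ jacobiSum-product n N ⟨
  jacobiSum (suc n) N                           ≡⟨ jacobiSum-low n N N≤n ⟩
  2 * (triangularUpTo (suc n) ⊗ partitions) N   ∎)
  where
  open ≡-Reasoning
  D = distinctPartsUpTo (suc n) ⊗ distinctPartsUpTo n

gauss-identity : distinctParts ⊗ distinctParts ≗ triangular ⊗ partitions
gauss-identity n = begin
  (distinctParts ⊗ distinctParts) n
    ≡⟨ ⊗-agree n (limit-agree distinctPartsUpTo-stable (n≤1+n n)) (limit-agree distinctPartsUpTo-stable ≤-refl) ⟩
  (distinctPartsUpTo (suc n) ⊗ distinctPartsUpTo n) n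
    ≡⟨ gauss-identity-upTo n n ≤-refl ⟩
  (triangularUpTo (suc n) ⊗ partitions) n
    ≡⟨ ⊗-agree n (λ i i≤n → sym (limit-agree triangularUpTo-stable ≤-refl i i≤n)) (λ _ _ → refl) ⟩
  (triangular ⊗ partitions) n
    ∎
  where open ≡-Reasoning

-- T₂ modulo 3 and modulo 2

3∣T₃ : ∀ ℓ n → ¬ 3 ∣ n → 3 ∣ T₃ ℓ n
3∣T₃ ℓ n 3∤n = m%n≡0⇒n∣m (T₃ ℓ n) 3 (begin
  T₃ ℓ n % 3             ≡⟨ cong (_% 3) (T₃≗cube ℓ n) ⟩
  (A ⊗ (A ⊗ A)) n % 3    ≡⟨ frobenius₃ A n ⟩
  dilate 3 A n % 3       ≡⟨ cong (_% 3) (dilate-off-multiples 3 A 3∤n) ⟩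
  0                      ∎)
  where
  open ≡-Reasoning
  A = regPart ℓ

odd⊗partitions : regPart 2 ⊗ partitions ≈ 𝟙 [mod 2 ]
odd⊗partitions = begin
  A ⊗ P
    ≈⟨ ≗⇒≈ 2 (⊗-identityʳ (A ⊗ P)) ⟨
  A ⊗ P ⊗ 𝟙
    ≈⟨ ⊗-cong-mod {f = A ⊗ P} (λ _ → refl) distinct⊗partitions ⟨
  A ⊗ P ⊗ (Q ⊗ P)
    ≈⟨ ≗⇒≈ 2 (solve 3 (λ A P Q → A :* P :* (Q :* P) := Q :* (A :* (P :* P))) (λ _ → refl) A P Q) ⟩
  Q ⊗ (A ⊗ (P ⊗ P))
    ≈⟨ ⊗-cong-mod {f = Q} (λ _ → refl) (⊗-cong-mod {f = A} (λ _ → refl) (frobenius₂ P)) ⟩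
  Q ⊗ (A ⊗ dilate 2 P)
    ≈⟨ ≗⇒≈ 2 (⊗-cong (λ _ → refl) euler-factorisation) ⟨
  Q ⊗ P
    ≈⟨ distinct⊗partitions ⟩
  𝟙
    ∎
  where
  open ≈-Reasoning 2
  A = regPart 2
  P = partitions
  Q = distinctParts

odd≈distinct : regPart 2 ≈ distinctParts [mod 2 ]
odd≈distinct = begin
  A                      ≈⟨ ≗⇒≈ 2 (⊗-identityʳ A) ⟨
  A ⊗ 𝟙                  ≈⟨ ⊗-cong-mod {f = A} (λ _ → refl) distinct⊗partitions ⟨
  A ⊗ (Q ⊗ P)            ≈⟨ ≗⇒≈ 2 (solve 3 (λ A P Q → A :* (Q :* P) := A :* P :* Q) (λ _ → refl) A P Q) ⟩
  A ⊗ P ⊗ Q              ≈⟨ ⊗-cong-mod {g = Q} odd⊗partitions (λ _ → refl) ⟩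
  𝟙 ⊗ Q                  ≈⟨ ≗⇒≈ 2 (⊗-identityˡ Q) ⟩
  Q                      ∎
  where
  open ≈-Reasoning 2
  A = regPart 2
  P = partitions
  Q = distinctParts

T₃-two≈triangular : T 2 3 ≈ triangular [mod 2 ]
T₃-two≈triangular = begin
  T 2 3                  ≈⟨ ≗⇒≈ 2 (T₃≗cube 2) ⟩
  A ⊗ (A ⊗ A)            ≈⟨ ⊗-cong-mod {f = A} (λ _ → refl) (⊗-cong-mod odd≈distinct odd≈distinct) ⟩
  A ⊗ (Q ⊗ Q)            ≈⟨ ≗⇒≈ 2 (⊗-cong (λ _ → refl) gauss-identity) ⟩
  A ⊗ (S ⊗ P)            ≈⟨ ≗⇒≈ 2 (solve 3 (λ A S P → A :* (S :* P) := S :* (A :* P)) (λ _ → refl) A S P) ⟩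
  S ⊗ (A ⊗ P)            ≈⟨ ⊗-cong-mod {f = S} (λ _ → refl) odd⊗partitions ⟩
  S ⊗ 𝟙                  ≈⟨ ≗⇒≈ 2 (⊗-identityʳ S) ⟩
  S                      ∎
  where
  open ≈-Reasoning 2
  A = regPart 2
  P = partitions
  Q = distinctParts
  S = triangular

2∣T₃-two : ∀ n → (∀ k → triangle k ≢ n) → 2 ∣ T₃ 2 n
2∣T₃-two n not-triangle =
  m%n≡0⇒n∣m (T₃ 2 n) 2 (trans (T₃-two≈triangular n) (cong (_% 2) (triangular-off n not-triangle)))

-- The arithmetic of N

prime∣square⇒∣ : ∀ {p y} → Prime p → p ∣ y * y → p ∣ y
prime∣square⇒∣ {y = y} p-prime p∣y² = reduce (euclidsLemma y y p-prime p∣y²)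

prime∤* : ∀ {p a b} → Prime p → ¬ p ∣ a → ¬ p ∣ b → ¬ p ∣ a * b
prime∤* {a = a} {b} p-prime p∤a p∤b p∣ab with euclidsLemma a b p-prime p∣ab
... | inj₁ p∣a = p∤a p∣a
... | inj₂ p∣b = p∤b p∣b

quotient<self : ∀ {q p n} → 1 < p → suc n ≡ q * p → q < suc n
quotient<self {zero}      _   _    = z<s
quotient<self {suc q} {p} 1<p n≡qp = subst (suc q <_) (sym n≡qp) (m<m*n (suc q) p 1<p)

-- Descent: p divides y and then s, and cancelling p² leaves the same equation for s / p.
y*y≡p*[s*s*X]⇒s≡0 : ∀ {p X} → Prime p → ¬ p ∣ X → ∀ s y → y * y ≡ p * (s * s * X) → s ≡ 0
y*y≡p*[s*s*X]⇒s≡0 {p} {X} p-prime p∤X = <-rec (λ s → ∀ y → y * y ≡ p * (s * s * X) → s ≡ 0) descent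
  where
  instance _ = prime⇒nonZero p-prime
  descent : ∀ s → (∀ {s'} → s' < s → ∀ y → y * y ≡ p * (s' * s' * X) → s' ≡ 0) →
            ∀ y → y * y ≡ p * (s * s * X) → s ≡ 0
  descent zero    _   _ _ = refl
  descent (suc s) rec y y²≡ with prime∣square⇒∣ {y = y} p-prime (divides (suc s * suc s * X) (trans y²≡ (*-comm p _)))
  ... | divides y' refl = trans 1+s≡s'p (cong (_* p) (rec s'<1+s y' y'²≡))
    where
    y'²p≡ : y' * y' * p ≡ suc s * suc s * X
    y'²p≡ = *-cancelˡ-≡ _ _ p (trans (rearrange y' p) y²≡)
      where
      rearrange : ∀ y' p → p * (y' * y' * p) ≡ y' * p * (y' * p)
      rearrange = solve-∀
    p∣1+s : p ∣ suc s
    p∣1+s with euclidsLemma (suc s * suc s) X p-prime (divides (y' * y') (sym y'²p≡))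
    ... | inj₁ p∣[1+s]² = prime∣square⇒∣ p-prime p∣[1+s]²
    ... | inj₂ p∣X      = contradiction p∣X p∤X
    s' = _∣_.quotient p∣1+s
    1+s≡s'p : suc s ≡ s' * p
    1+s≡s'p = _∣_.equality p∣1+s
    s'<1+s : s' < suc s
    s'<1+s = quotient<self (nonTrivial⇒n>1 p {{prime⇒nonTrivial p-prime}}) 1+s≡s'p
    y'²≡ : y' * y' ≡ p * (s' * s' * X)
    y'²≡ = *-cancelʳ-≡ _ _ p (trans y'²p≡ (trans (cong (λ x → x * x * X) 1+s≡s'p) (rearrange s' p X)))
      where
      rearrange : ∀ s' p X → s' * p * (s' * p) * X ≡ p * (s' * s' * X) * p
      rearrange = solve-∀

square-of-odd : ∀ k → (1 + 2 * k) * (1 + 2 * k) ≡ 1 + 8 * triangle k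
square-of-odd k = trans (expand k) (trans (cong (λ x → 1 + 4 * x) (sym (triangle-double k))) (regroup (triangle k)))
  where
  expand : ∀ k → (1 + 2 * k) * (1 + 2 * k) ≡ 1 + 4 * (k * suc k)
  expand = solve-∀
  regroup : ∀ a → 1 + 4 * (2 * a) ≡ 1 + 8 * a
  regroup = solve-∀
  triangle-double : ∀ k → 2 * triangle k ≡ k * suc k
  triangle-double zero    = refl
  triangle-double (suc k) = trans (distrib (triangle k) k) (trans (cong (_+ 2 * suc k) (triangle-double k)) (factor k))
    where
    distrib : ∀ a k → 2 * (a + suc k) ≡ 2 * a + 2 * suc k
    distrib = solve-∀
    factor : ∀ k → k * suc k + 2 * suc k ≡ suc k * suc (suc k)
    factor = solve-∀

coprime6⇒odd : ∀ t → gcd t 6 ≡ 1 → ∃ λ u → t ≡ 1 + 2 * u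
coprime6⇒odd t gcd≡1 with t % 2 | m≡m%n+[m/n]*n t 2 | m%n<n t 2
... | 0           | t≡ | _ = contradiction (∣⇒≤ 2∣1) (<-irrefl refl)
  where
  2∣1 : 2 ∣ 1
  2∣1 = subst (2 ∣_) gcd≡1 (gcd-greatest (divides (t / 2) t≡) (divides 3 refl))
... | 1           | t≡ | _ = t / 2 , trans t≡ (cong suc (*-comm (t / 2) 2))
... | suc (suc _) | _  | s≤s (s≤s ())

module Progression {p : ℕ} .{{_ : NonZero p}} (t s u n j : ℕ) (t≡sp : t ≡ s * p) (t≡odd : t ≡ 1 + 2 * u) where

  N : ℕ
  N = 9 * t * t * n + 9 * t * s * j + (57 * triangle u + 7)

  X : ℕ
  X = 3 * (24 * p * n + 24 * j + 19 * p)

  t*t≡ : t * t ≡ 1 + 8 * triangle u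
  t*t≡ = trans (cong (λ x → x * x) t≡odd) (square-of-odd u)

  N≡ : 9 * t * t * n + (9 * t * t * j) / p + (57 * t * t ∸ 1) / 8 ≡ N
  N≡ = cong₂ (λ a b → 9 * t * t * n + a + b) first second
    where
    first : (9 * t * t * j) / p ≡ 9 * t * s * j
    first = trans (cong (_/ p) (trans (cong (λ x → 9 * t * x * j) t≡sp) (regroup t s p j))) (m*n/n≡m (9 * t * s * j) p)
      where
      regroup : ∀ t s p j → 9 * t * (s * p) * j ≡ 9 * t * s * j * p
      regroup = solve-∀
    second : (57 * t * t ∸ 1) / 8 ≡ 57 * triangle u + 7
    second = trans (cong (λ x → (x ∸ 1) / 8) 57t²≡) (m*n/n≡m (57 * triangle u + 7) 8)
      where
      regroup : ∀ t a → t * t ≡ 1 + 8 * a → 57 * t * t ≡ suc ((57 * a + 7) * 8)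
      regroup t a t²≡ = trans (*-assoc 57 t t) (trans (cong (57 *_) t²≡) (expand a))
        where
        expand : ∀ a → 57 * (1 + 8 * a) ≡ suc ((57 * a + 7) * 8)
        expand = solve-∀
      57t²≡ : 57 * t * t ≡ suc ((57 * triangle u + 7) * 8)
      57t²≡ = regroup t (triangle u) t*t≡

  3∤N : ¬ 3 ∣ N
  3∤N 3∣N = >⇒∤ (s≤s (s≤s z≤n)) (∣m+n∣m⇒∣n (subst (3 ∣_) (split t s (triangle u) n j) 3∣N) (m∣m*n q))
    where
    q = 3 * t * t * n + 3 * t * s * j + 19 * triangle u + 2
    split : ∀ t s a n j → 9 * t * t * n + 9 * t * s * j + (57 * a + 7) ≡ 3 * (3 * t * t * n + 3 * t * s * j + 19 * a + 2) + 1
    split = solve-∀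

  8N+1≡ : 8 * N + 1 ≡ p * (s * s * X)
  8N+1≡ = begin
    8 * N + 1
      ≡⟨ expand t s (triangle u) n j ⟩
    72 * t * t * n + 72 * t * s * j + 57 * (1 + 8 * triangle u)
      ≡⟨ cong (λ x → 72 * t * t * n + 72 * t * s * j + 57 * x) t*t≡ ⟨
    72 * t * t * n + 72 * t * s * j + 57 * (t * t)
      ≡⟨ cong (λ t → 72 * t * t * n + 72 * t * s * j + 57 * (t * t)) t≡sp ⟩
    72 * (s * p) * (s * p) * n + 72 * (s * p) * s * j + 57 * (s * p * (s * p))
      ≡⟨ factor s p n j ⟩
    p * (s * s * X)
      ∎
    where
    open ≡-Reasoning
    expand : ∀ t s a n j → 8 * (9 * t * t * n + 9 * t * s * j + (57 * a + 7)) + 1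
                         ≡ 72 * t * t * n + 72 * t * s * j + 57 * (1 + 8 * a)
    expand = solve-∀
    factor : ∀ s p n j → 72 * (s * p) * (s * p) * n + 72 * (s * p) * s * j + 57 * (s * p * (s * p))
                       ≡ p * (s * s * (3 * (24 * p * n + 24 * j + 19 * p)))
    factor = solve-∀

p∤X : ∀ {p} n j → Prime p → 5 ≤ p → 0 < j → j < p → ¬ p ∣ 3 * (24 * p * n + 24 * j + 19 * p)
p∤X {p} n j p-prime 5≤p 0<j j<p = prime∤* p-prime p∤3 p∤Y
  where
  p∤2 : ¬ p ∣ 2
  p∤2 = >⇒∤ (≤-trans (s≤s (s≤s (s≤s z≤n))) 5≤p)
  p∤3 : ¬ p ∣ 3
  p∤3 = >⇒∤ (≤-trans (s≤s (s≤s (s≤s (s≤s z≤n)))) 5≤p)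
  p∤24j : ¬ p ∣ 24 * j
  p∤24j = prime∤* p-prime (prime∤* p-prime p∤2 (prime∤* p-prime p∤2 (prime∤* p-prime p∤2 p∤3)))
                          (>⇒∤ {{>-nonZero 0<j}} j<p)
  p∤Y : ¬ p ∣ 24 * p * n + 24 * j + 19 * p
  p∤Y p∣Y = p∤24j (∣m+n∣m⇒∣n (subst (p ∣_) (regroup p n j) p∣Y) (m∣m*n (24 * n + 19)))
    where
    regroup : ∀ p n j → 24 * p * n + 24 * j + 19 * p ≡ p * (24 * n + 19) + 24 * j
    regroup = solve-∀

corollary1p3 : (p t : ℕ) → .{{_ : NonZero p}} → Prime p → 5 ≤ p →
    ¬ (∃ λ x → p ∣ (x * x + 2)) →
    1 ≤ t → gcd t 6 ≡ 1 → p ∣ t →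
    (n j : ℕ) → 1 ≤ j → j ≤ p ∸ 1 →
    6 ∣ T₃ 2 (9 * t * t * n + (9 * t * t * j) / p + (57 * t * t ∸ 1) / 8)
corollary1p3 p t p-prime 5≤p _ 1≤t gcd≡1 (divides s t≡sp) n j 1≤j j≤p∸1 with coprime6⇒odd t gcd≡1
... | u , t≡odd = subst (λ m → 6 ∣ T₃ 2 m) (sym N≡) (lcm-least (2∣T₃-two N not-triangular) (3∣T₃ 2 N 3∤N))
  where
  open Progression t s u n j t≡sp t≡odd
  s≢0 : s ≢ 0
  s≢0 refl = <-irrefl (sym t≡sp) 1≤t
  j<p : j < p
  j<p = ≤-trans (s≤s j≤p∸1) (≤-reflexive (suc-pred p))
  not-triangular : ∀ k → triangle k ≢ N
  not-triangular k triangle≡N = s≢0 (y*y≡p*[s*s*X]⇒s≡0 p-prime (p∤X n j p-prime 5≤p 1≤j j<p) s (1 + 2 * k) (begin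
    (1 + 2 * k) * (1 + 2 * k)   ≡⟨ square-of-odd k ⟩
    1 + 8 * triangle k          ≡⟨ cong (λ x → 1 + 8 * x) triangle≡N ⟩
    1 + 8 * N                   ≡⟨ +-comm 1 (8 * N) ⟩
    8 * N + 1                   ≡⟨ 8N+1≡ ⟩
    p * (s * s * X)             ∎))
    where open ≡-Reasoning
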